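{- Let $n$ be a prime with $n \equiv 1 \pmod 6$, let $\alpha$ be a primitive element of $\mathbb{F}_{2^n}$, and identify $\mathbb{F}_2^n$ with $\mathbb{F}_{2^n}$ via a fixed $\mathbb{F}_2$-linear isomorphism. For $s \in \mathbb{Z}_{2^n-1}$ let $C_s = \{ s \cdot 2^i : 0 \le i \le n-1\} \subseteq \mathbb{Z}_{2^n-1}$ be its cyclotomic coset, and let $C(s)$ denote the smallest element of $C_s$. For a $3$-dimensional subspace $X = \{0, \alpha^{i_1}, \ldots, \alpha^{i_7}\}$ of $\mathbb{F}_2^n$ let $C(\Delta(X)) = \{ C(i_r - i_s) : 1 \le r,s \le 7,\ r \ne s\}$ (differences modulo $2^n-1$). Call $X$ coset complete if $|C(\Delta(X))| = 42$, and call two coset complete subspaces $X, Y$ disjoint coset complete if $C(\Delta(X)) \cap C(\Delta(Y)) = \emptyset$. If there exist $\frac{2^n-2}{42n}$ pairwise disjoint coset complete $3$-dimensional subspaces of $\mathbb{F}_2^n$, then there exists a Steiner structure $S_2[2,3,n]$.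
   Context: A Steiner structure $S_q[t,k,n]$ is a set $S$ of $k$-dimensional subspaces of $\mathbb{F}_q^n$ such that each $t$-dimensional subspace of $\mathbb{F}_q^n$ is contained in exactly one subspace of $S$. -}

module Defs where

open import Data.Bool using (Bool; true; false; _xor_; _∧_; _∨_; if_then_else_)
import Data.Bool as B
open import Data.Nat using (ℕ; zero; suc; _+_; _*_; _∸_; _^_; _<_; _⊓_; _≟_)
open import Data.Nat.DivMod using (_%_)
open import Data.Fin using (Fin)
import Data.Fin as F
open import Data.Vec using (Vec; []; _∷_; replicate; zipWith; init; last; toList)
import Data.Vec.Properties as VP
open import Data.List using (List; []; _∷_; [_]; _++_; map; foldr; concatMap; allFin; upTo; length; deduplicate)
open import Data.Bool.ListAction using (any)
open import Data.List.Membership.Propositional using (_∈_)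
open import Data.Product using (Σ; ∃; _×_)
open import Data.Empty using (⊥)
open import Relation.Nullary using (does; ¬_)
open import Relation.Binary.PropositionalEquality using (_≡_)

V : ℕ → Set
V n = Vec Bool n

_⊕_ : ∀ {n} → V n → V n → V n
_⊕_ = zipWith _xor_

0v : ∀ {n} → V n
0v = replicate _ false

_≟v_ : ∀ {n} (u v : V n) → Relation.Nullary.Dec (u ≡ v)
_≟v_ = VP.≡-dec B._≟_

allVecs : ∀ n → List (V n)
allVecs zero = [ [] ]
allVecs (suc n) = map (false ∷_) (allVecs n) ++ map (true ∷_) (allVecs n)

VSet : ℕ → Set
VSet n = V n → Bool

countTrue : ∀ {n} → VSet n → List (V n) → ℕ
countTrue P [] = 0
countTrue P (v ∷ vs) = if P v then suc (countTrue P vs) else countTrue P vs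

card : ∀ {n} → VSet n → ℕ
card {n} P = countTrue P (allVecs n)

IsSubspace : ∀ {n} → VSet n → Set
IsSubspace P = (P 0v ≡ true) × (∀ u v → P u ≡ true → P v ≡ true → P (u ⊕ v) ≡ true)

IsSubspaceOfDim : ∀ {n} → ℕ → VSet n → Set
IsSubspaceOfDim k P = IsSubspace P × (card P ≡ 2 ^ k)

_⊆_ : ∀ {n} → VSet n → VSet n → Set
P ⊆ Q = ∀ v → P v ≡ true → Q v ≡ true

SteinerStructure2 : (t k n : ℕ) → Set
SteinerStructure2 t k n =
  Σ ℕ λ m → Σ (Fin m → VSet n) λ S →
    (∀ i → IsSubspaceOfDim k (S i)) ×
    (∀ (T : VSet n) → IsSubspaceOfDim t T →
       ∃ λ i → (T ⊆ S i) × (∀ j → T ⊆ S j → j ≡ i))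

-- The ring F_2[x]/(f), f = x^n + f_{n-1} x^{n-1} + ... + f_0 monic of
-- degree n, given by its lower coefficient vector (f_0 , ... , f_{n-1}).
-- Elements are coefficient vectors (c_0 , ... , c_{n-1}) in F_2^n; this is
-- the F_2-linear identification of F_2^n with the field.

mulX : ∀ {n} → V n → V n → V n
mulX {zero} f a = []
mulX {suc m} f a = zipWith _xor_ (false ∷ init a) (Data.Vec.map (last a ∧_) f)

scale : ∀ {n} → Bool → V n → V n
scale b a = if b then a else 0v

mul : ∀ {n} → V n → V n → V n → V n
mul f a b = foldr (λ bi acc → mulX f acc ⊕ scale bi a) 0v (toList b)

one : ∀ n → V n
one zero = []
one (suc m) = true ∷ replicate m false

pow : ∀ {n} → V n → V n → ℕ → V n
pow {n} f α zero = one n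
pow f α (suc i) = mul f α (pow f α i)

IsFieldMod : ∀ {n} → V n → Set
IsFieldMod {n} f = ∀ (a : V n) → ¬ (a ≡ 0v) → ∃ λ b → mul f a b ≡ one n

IsPrimitive : ∀ {n} → V n → V n → Set
IsPrimitive {n} f α =
  ∀ (x : V n) → ¬ (x ≡ 0v) → ∃ λ i → (i < 2 ^ n ∸ 1) × (pow f α i ≡ x)

-- x mod N (with x mod 0 = x; only used for N = 2^n - 1 > 0)
modN : ℕ → ℕ → ℕ
modN x zero = x
modN x (suc k) = x % suc k

ordN : ℕ → ℕ
ordN n = 2 ^ n ∸ 1

cosetMin : ℕ → ℕ → ℕ
cosetMin n s = foldr _⊓_ (modN s (ordN n)) (map (λ i → modN (s * 2 ^ i) (ordN n)) (upTo n))

-- i - j mod (2^n - 1), for i , j ∈ Z_{2^n-1} (i.e. i , j < 2^n - 1)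
diffMod : ℕ → ℕ → ℕ → ℕ
diffMod n i j = modN (i + ordN n ∸ j) (ordN n)

ofExps : ∀ {n} → V n → V n → (Fin 7 → ℕ) → VSet n
ofExps f α e v = does (v ≟v 0v) ∨ any (λ r → does (v ≟v pow f α (e r))) (allFin 7)

-- C(Δ(X)) as a list (possibly with repetitions) of C(i_r - i_s), r ≠ s
CΔ : ℕ → (Fin 7 → ℕ) → List ℕ
CΔ n e = concatMap (λ r → concatMap (λ s →
           if does (r F.≟ s) then [] else [ cosetMin n (diffMod n (e r) (e s)) ])
           (allFin 7)) (allFin 7)

CosetComplete : ℕ → (Fin 7 → ℕ) → Set
CosetComplete n e = length (deduplicate _≟_ (CΔ n e)) ≡ 42

DisjointCΔ : ℕ → (Fin 7 → ℕ) → (Fin 7 → ℕ) → Set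
DisjointCΔ n e e' = ∀ c → c ∈ CΔ n e → c ∈ CΔ n e' → ⊥

IsCCSubspace : ∀ {n} → V n → V n → (Fin 7 → ℕ) → Set
IsCCSubspace {n} f α e =
  (∀ r → e r < ordN n) × IsSubspaceOfDim 3 (ofExps f α e) × CosetComplete n e

module Submission where

-- Write N = 2ⁿ - 1 and identify the nonzero field elements with exponents of the
-- primitive element α, so that a 3-dimensional subspace X = {0} ∪ {α^(e r) : r < 7} is described
-- by its exponents e.  The blocks of the Steiner structure are the images
--     αᵗ X_k^(2ⁱ)     (k < M, i < n, t < N)
-- of the given subspaces under the additive bijections u ↦ αᵗ u^(2ⁱ); each is again a
-- 3-dimensional subspace.  A plane T = {0, α^a, α^b, α^a + α^b} lies in αᵗ X_k^(2ⁱ) exactly when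
-- b - a ≡ 2ⁱ (e_k(r) - e_k(s)) and a ≡ t + 2ⁱ e_k(s) for some r ≠ s.  Since n is prime every
-- nonzero cyclotomic coset modulo N has exactly n elements; the M disjoint coset-complete
-- subspaces provide 42M = (N - 1)/n distinct cosets, hence every nonzero coset, which gives
-- existence.  Uniqueness follows from disjointness (same k), coset completeness (same r , s),
-- the size n of the coset (same i), and cancellation (same t).

open import Defs
open import Data.Nat using (ℕ; _*_; _∸_; _^_; _%_)
open import Data.Nat.Primality using (Prime)
open import Data.Fin using (Fin)
open import Data.Product using (Σ; _×_)
open import Relation.Nullary using (¬_)
open import Relation.Binary.PropositionalEquality using (_≡_)
open import Data.Nat using (suc; _<_)


module Counting where
  open import Data.Bool using (Bool; true; false)
  open import Data.Bool.Properties using (T?)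
  import Data.Bool.Properties as Bool
  open import Data.Nat using (ℕ; zero; suc; _+_; _^_; _≤_; _<_; z≤n; s≤s; pred)
  import Data.Nat as ℕ
  open import Data.Nat.Properties using (≤-antisym; <-irrefl; <⇒≱; +-identityʳ)
  open import Data.Vec using ([]; _∷_)
  open import Data.Vec.Properties using (∷-injective)
  open import Data.List using (List; []; _∷_; _++_; length; map; filter; deduplicate)
  open import Data.List.Properties using (length-++; length-map; length-filter; filter-notAll; length-deduplicate)
  open import Data.List.Membership.Propositional using (_∈_; _∉_)
  open import Data.List.Membership.Propositional.Properties
    using (∈-∃++; ∈-++⁺ˡ; ∈-++⁺ʳ; ∈-map⁺; ∈-map⁻; ∈-filter⁺; ∈-filter⁻; ∈-deduplicate⁺)
  import Data.List.Membership.DecPropositional as DecMembership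
  open import Data.List.Relation.Unary.Any using (Any; here; there; any?)
  import Data.List.Relation.Unary.Any as Any
  open import Data.List.Relation.Unary.All using (All; []; _∷_)
  import Data.List.Relation.Unary.All as All
  open import Data.List.Relation.Unary.Unique.Propositional using (Unique)
  open import Data.List.Relation.Unary.Unique.Propositional.Properties using (map⁺; ++⁺; filter⁺)
  open import Data.List.Relation.Unary.AllPairs using ([]; _∷_)
  open import Data.Product using (_,_; _×_; ∃; proj₂)
  open import Data.Empty using (⊥; ⊥-elim)
  open import Relation.Nullary using (¬_; ¬?; yes; no)
  open import Relation.Nullary.Decidable using (_×-dec_)
  open import Relation.Binary.PropositionalEquality using (_≡_; refl; sym; trans; cong; cong₂; subst)
  open import Function using (_∘_)
  open import Function.Bundles using (Equivalence)
  open Relation.Binary.PropositionalEquality.≡-Reasoning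

  module _ {A : Set} where

    ∉-from-All : ∀ {x : A} {xs} → All (λ y → ¬ x ≡ y) xs → x ∉ xs
    ∉-from-All (p ∷ ps) (here eq) = p eq
    ∉-from-All (p ∷ ps) (there m) = ∉-from-All ps m

    ∈-remove-middle : ∀ {x y : A} us vs → y ∈ us ++ x ∷ vs → ¬ y ≡ x → y ∈ us ++ vs
    ∈-remove-middle []       vs (here eq) y≢x = ⊥-elim (y≢x eq)
    ∈-remove-middle []       vs (there m) y≢x = m
    ∈-remove-middle (u ∷ us) vs (here eq) y≢x = here eq
    ∈-remove-middle (u ∷ us) vs (there m) y≢x = there (∈-remove-middle us vs m y≢x)

    length-middle : ∀ (x : A) us vs → length (us ++ x ∷ vs) ≡ suc (length (us ++ vs))
    length-middle x []       vs = refl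
    length-middle x (u ∷ us) vs = cong suc (length-middle x us vs)

    pigeonhole : ∀ {xs ys : List A} → Unique xs → (∀ {z} → z ∈ xs → z ∈ ys) → length xs ≤ length ys
    pigeonhole {[]}     _          _   = z≤n
    pigeonhole {x ∷ xs} {ys} (x∉xs ∷ u) sub with ∈-∃++ (sub (here refl))
    ... | us , vs , ys≡ = subst (suc (length xs) ≤_) (sym (trans (cong length ys≡) (length-middle x us vs)))
          (s≤s (pigeonhole u λ {z} z∈xs → ∈-remove-middle us vs (subst (z ∈_) ys≡ (sub (there z∈xs)))
                                                (λ z≡x → ∉-from-All x∉xs (subst (_∈ xs) z≡x z∈xs))))

  -- If deduplication does not shorten a list of naturals, the list had no duplicates.
  -- (Coset completeness, |C(Δ(X))| = 42, is stated through deduplicate.)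
  deduplicate-length⇒Unique : ∀ (xs : List ℕ) → length (deduplicate ℕ._≟_ xs) ≡ length xs → Unique xs
  deduplicate-length⇒Unique []       _   = []
  deduplicate-length⇒Unique (x ∷ xs) len = x∉xs ∷ deduplicate-length⇒Unique xs len-xs
    where
    D others : List ℕ
    D = deduplicate ℕ._≟_ xs
    others = filter (¬? ∘ (x ℕ.≟_)) D
    len-others : length others ≡ length xs
    len-others = cong pred len
    len-xs : length D ≡ length xs
    len-xs = ≤-antisym (length-deduplicate ℕ._≟_ xs) (subst (_≤ length D) len-others (length-filter (¬? ∘ (x ℕ.≟_)) D))
    -- nothing is removed by the filter, so x does not occur in D
    no-copy : ¬ Any (λ y → ¬ ¬ x ≡ y) D
    no-copy a = <-irrefl (trans len-others (sym len-xs)) (filter-notAll (¬? ∘ (x ℕ.≟_)) D a)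
    x∉xs : All (λ y → ¬ x ≡ y) xs
    x∉xs = All.tabulate λ y∈xs x≡y →
      no-copy (Any.map (λ y≡z x≢z → x≢z (trans x≡y y≡z)) (∈-deduplicate⁺ ℕ._≟_ y∈xs))

  allVecs-complete : ∀ n (v : V n) → v ∈ allVecs n
  allVecs-complete zero    []          = here refl
  allVecs-complete (suc n) (false ∷ v) = ∈-++⁺ˡ (∈-map⁺ (false ∷_) (allVecs-complete n v))
  allVecs-complete (suc n) (true ∷ v)  = ∈-++⁺ʳ (map (false ∷_) (allVecs n)) (∈-map⁺ (true ∷_) (allVecs-complete n v))

  allVecs-unique : ∀ n → Unique (allVecs n)
  allVecs-unique zero    = [] ∷ []
  allVecs-unique (suc n) = ++⁺ (map⁺ tail-injective (allVecs-unique n)) (map⁺ tail-injective (allVecs-unique n)) disjoint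
    where
    tail-injective : ∀ {b} {u v : V n} → b ∷ u ≡ b ∷ v → u ≡ v
    tail-injective e = proj₂ (∷-injective e)
    disjoint : ∀ {v} → v ∈ map (false ∷_) (allVecs n) × v ∈ map (true ∷_) (allVecs n) → ⊥
    disjoint (m₁ , m₂) with ∈-map⁻ (false ∷_) m₁ | ∈-map⁻ (true ∷_) m₂
    ... | _ , _ , refl | _ , _ , ()

  length-allVecs : ∀ n → length (allVecs n) ≡ 2 ^ n
  length-allVecs zero    = refl
  length-allVecs (suc n) = begin
    length (map (false ∷_) (allVecs n) ++ map (true ∷_) (allVecs n))
      ≡⟨ length-++ (map (false ∷_) (allVecs n)) ⟩
    length (map (false ∷_) (allVecs n)) + length (map (true ∷_) (allVecs n))
      ≡⟨ cong₂ _+_ (length-map (false ∷_) (allVecs n)) (length-map (true ∷_) (allVecs n)) ⟩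
    length (allVecs n) + length (allVecs n)
      ≡⟨ cong (λ z → z + z) (length-allVecs n) ⟩
    2 ^ n + 2 ^ n
      ≡⟨ cong (2 ^ n +_) (sym (+-identityʳ (2 ^ n))) ⟩
    2 ^ suc n ∎

  members : ∀ {n} → VSet n → List (V n) → List (V n)
  members P = filter (λ v → T? (P v))

  countTrue≡length : ∀ {n} (P : VSet n) vs → countTrue P vs ≡ length (members P vs)
  countTrue≡length P []       = refl
  countTrue≡length P (v ∷ vs) with P v
  ... | true  = cong suc (countTrue≡length P vs)
  ... | false = countTrue≡length P vs

  card-≥ : ∀ {n} (P : VSet n) ws → Unique ws → (∀ {w} → w ∈ ws → P w ≡ true) → length ws ≤ card P
  card-≥ {n} P ws u ws⊆P = subst (_ ≤_) (sym (countTrue≡length P (allVecs n)))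
    (pigeonhole u λ {w} m → ∈-filter⁺ (λ v → T? (P v)) (allVecs-complete n w) (Equivalence.from Bool.T-≡ (ws⊆P m)))

  card-≤ : ∀ {n} (P : VSet n) ws → (∀ v → P v ≡ true → v ∈ ws) → card P ≤ length ws
  card-≤ {n} P ws P⊆ws = subst (_≤ _) (sym (countTrue≡length P (allVecs n)))
    (pigeonhole (filter⁺ (λ v → T? (P v)) (allVecs-unique n))
      λ m → let _ , Pv = ∈-filter⁻ (λ v → T? (P v)) {xs = allVecs n} m in P⊆ws _ (Equivalence.to Bool.T-≡ Pv))

  module _ {n : ℕ} where
    open DecMembership (_≟v_ {n}) using (_∈?_)

    find-outside : (P : VSet n) (ws : List (V n)) → length ws < card P → ∃ λ v → (P v ≡ true) × (v ∉ ws)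
    find-outside P ws lt with any? (λ v → (P v Bool.≟ true) ×-dec ¬? (v ∈? ws)) (allVecs n)
    ... | yes found = Any.satisfied found
    ... | no none   = ⊥-elim (<⇒≱ lt (card-≤ P ws P⊆ws))
      where
      P⊆ws : ∀ v → P v ≡ true → v ∈ ws
      P⊆ws v Pv with v ∈? ws
      ... | yes v∈ws = v∈ws
      ... | no  v∉ws = ⊥-elim (none (Any.map (λ { refl → Pv , v∉ws }) (allVecs-complete n v)))

module VectorSpace where
  open Counting
  open import Data.Bool using (false; true; _xor_)
  open import Data.Bool.Properties using (xor-comm; xor-assoc; xor-identityˡ; xor-identityʳ)
  open import Data.Nat using (ℕ; _≤_; _<_; z≤n; s≤s)
  open import Data.Nat.Properties using (<-irrefl)
  open import Data.Vec using ([]; _∷_)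
  open import Data.Vec.Properties using (zipWith-comm; zipWith-assoc; zipWith-identityˡ; zipWith-identityʳ)
  open import Data.List using (List; []; _∷_)
  open import Data.List.Membership.Propositional using (_∈_; _∉_)
  import Data.List.Membership.DecPropositional as DecMembership
  open import Data.List.Relation.Unary.Any using (here; there)
  open import Data.List.Relation.Unary.All using ([]; _∷_)
  import Data.List.Relation.Unary.All as All
  open import Data.List.Relation.Unary.Unique.Propositional using (Unique)
  open import Data.List.Relation.Unary.AllPairs using ([]; _∷_)
  open import Data.Product using (_,_; _×_; ∃; proj₁; proj₂)
  open import Data.Empty using (⊥-elim)
  open import Relation.Nullary using (¬_; yes; no)
  open import Relation.Binary.PropositionalEquality using (_≡_; refl; sym; trans; cong; subst)
  open Relation.Binary.PropositionalEquality.≡-Reasoning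

  ⊕-self : ∀ {n} (u : V n) → u ⊕ u ≡ 0v
  ⊕-self []          = refl
  ⊕-self (false ∷ u) = cong (false ∷_) (⊕-self u)
  ⊕-self (true ∷ u)  = cong (false ∷_) (⊕-self u)

  module _ {n : ℕ} where

    ⊕-comm : ∀ (u v : V n) → u ⊕ v ≡ v ⊕ u
    ⊕-comm = zipWith-comm xor-comm

    ⊕-assoc : ∀ (u v w : V n) → (u ⊕ v) ⊕ w ≡ u ⊕ (v ⊕ w)
    ⊕-assoc = zipWith-assoc xor-assoc

    ⊕-identityˡ : ∀ (u : V n) → 0v ⊕ u ≡ u
    ⊕-identityˡ = zipWith-identityˡ xor-identityˡ

    ⊕-identityʳ : ∀ (u : V n) → u ⊕ 0v ≡ u
    ⊕-identityʳ = zipWith-identityʳ xor-identityʳ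

    ⊕-interchange : ∀ (p q r s : V n) → (p ⊕ q) ⊕ (r ⊕ s) ≡ (p ⊕ r) ⊕ (q ⊕ s)
    ⊕-interchange p q r s = begin
      (p ⊕ q) ⊕ (r ⊕ s) ≡⟨ ⊕-assoc p q (r ⊕ s) ⟩
      p ⊕ (q ⊕ (r ⊕ s)) ≡⟨ cong (p ⊕_) (sym (⊕-assoc q r s)) ⟩
      p ⊕ ((q ⊕ r) ⊕ s) ≡⟨ cong (λ z → p ⊕ (z ⊕ s)) (⊕-comm q r) ⟩
      p ⊕ ((r ⊕ q) ⊕ s) ≡⟨ cong (p ⊕_) (⊕-assoc r q s) ⟩
      p ⊕ (r ⊕ (q ⊕ s)) ≡⟨ sym (⊕-assoc p r (q ⊕ s)) ⟩
      (p ⊕ r) ⊕ (q ⊕ s) ∎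

    ⊕≡0⇒≡ : ∀ (u v : V n) → u ⊕ v ≡ 0v → u ≡ v
    ⊕≡0⇒≡ u v e = begin
      u             ≡⟨ sym (⊕-identityʳ u) ⟩
      u ⊕ 0v        ≡⟨ cong (u ⊕_) (sym (⊕-self v)) ⟩
      u ⊕ (v ⊕ v)   ≡⟨ sym (⊕-assoc u v v) ⟩
      (u ⊕ v) ⊕ v   ≡⟨ cong (_⊕ v) e ⟩
      0v ⊕ v        ≡⟨ ⊕-identityˡ v ⟩
      v             ∎

    ⊕≡ˡ⇒0 : ∀ (u v : V n) → u ⊕ v ≡ u → v ≡ 0v
    ⊕≡ˡ⇒0 u v e = begin
      v             ≡⟨ sym (⊕-identityˡ v) ⟩
      0v ⊕ v        ≡⟨ cong (_⊕ v) (sym (⊕-self u)) ⟩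
      (u ⊕ u) ⊕ v   ≡⟨ ⊕-assoc u u v ⟩
      u ⊕ (u ⊕ v)   ≡⟨ cong (u ⊕_) e ⟩
      u ⊕ u         ≡⟨ ⊕-self u ⟩
      0v            ∎

    ⊕≡ʳ⇒0 : ∀ (u v : V n) → u ⊕ v ≡ v → u ≡ 0v
    ⊕≡ʳ⇒0 u v e = ⊕≡ˡ⇒0 v u (trans (⊕-comm v u) e)

  record Plane {n : ℕ} (T : VSet n) : Set where
    field
      u v   : V n
      u≢0   : ¬ (u ≡ 0v)
      v≢0   : ¬ (v ≡ 0v)
      u≢v   : ¬ (u ≡ v)
      u∈T   : T u ≡ true
      v∈T   : T v ≡ true
      T⊆span : ∀ w → T w ≡ true → w ∈ (0v ∷ u ∷ v ∷ (u ⊕ v) ∷ [])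

  module _ {n : ℕ} where
    open DecMembership (_≟v_ {n}) using (_∈?_)

    -- Pick u ∉ {0} and v ∉ {0,u} in T; then {0,u,v,u⊕v} are four distinct members,
    -- and as |T| = 4 there is no room for a fifth one.
    plane : (T : VSet n) → IsSubspaceOfDim 2 T → Plane T
    plane T ((0∈T , ⊕-closed) , |T|≡4) = record
      { u = u ; v = v ; u≢0 = u≢0 ; v≢0 = v≢0 ; u≢v = u≢v ; u∈T = u∈T ; v∈T = v∈T ; T⊆span = T⊆span }
      where
      first : ∃ λ u → (T u ≡ true) × (u ∉ 0v ∷ [])
      first = find-outside T (0v ∷ []) (subst (1 <_) (sym |T|≡4) (s≤s (s≤s z≤n)))
      u : V n
      u = proj₁ first
      u∈T = proj₁ (proj₂ first)
      u≢0 : ¬ (u ≡ 0v)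
      u≢0 e = proj₂ (proj₂ first) (here e)
      second : ∃ λ v → (T v ≡ true) × (v ∉ 0v ∷ u ∷ [])
      second = find-outside T (0v ∷ u ∷ []) (subst (2 <_) (sym |T|≡4) (s≤s (s≤s (s≤s z≤n))))
      v : V n
      v = proj₁ second
      v∈T = proj₁ (proj₂ second)
      v≢0 : ¬ (v ≡ 0v)
      v≢0 e = proj₂ (proj₂ second) (here e)
      u≢v : ¬ (u ≡ v)
      u≢v e = proj₂ (proj₂ second) (there (here (sym e)))
      span : List (V n)
      span = 0v ∷ u ∷ v ∷ (u ⊕ v) ∷ []
      span-unique : Unique span
      span-unique =
          ((λ e → u≢0 (sym e)) ∷ (λ e → v≢0 (sym e)) ∷ (λ e → u≢v (⊕≡0⇒≡ u v (sym e))) ∷ [])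
        ∷ (u≢v ∷ (λ e → v≢0 (⊕≡ˡ⇒0 u v (sym e))) ∷ [])
        ∷ ((λ e → u≢0 (⊕≡ʳ⇒0 u v (sym e))) ∷ [])
        ∷ [] ∷ []
      span⊆T : ∀ {w} → w ∈ span → T w ≡ true
      span⊆T (here refl)                         = 0∈T
      span⊆T (there (here refl))                 = u∈T
      span⊆T (there (there (here refl)))         = v∈T
      span⊆T (there (there (there (here refl)))) = ⊕-closed u v u∈T v∈T
      T⊆span : ∀ w → T w ≡ true → w ∈ span
      T⊆span w w∈T with w ∈? span
      ... | yes w∈span = w∈span
      ... | no  w∉span = ⊥-elim (<-irrefl refl (subst (5 ≤_) |T|≡4 (card-≥ T (w ∷ span) unique5 ⊆T)))
        where
        unique5 : Unique (w ∷ span)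
        unique5 = All.tabulate (λ m e → w∉span (subst (_∈ span) (sym e) m)) ∷ span-unique
        ⊆T : ∀ {x} → x ∈ w ∷ span → T x ≡ true
        ⊆T (here refl) = w∈T
        ⊆T (there m)   = span⊆T m

  plane-⊆ : ∀ {n} {T B : VSet n} (p : Plane T) → IsSubspace B →
            B (Plane.u p) ≡ true → B (Plane.v p) ≡ true → T ⊆ B
  plane-⊆ {B = B} p (0∈B , ⊕-closed) u∈B v∈B w w∈T = spanned (Plane.T⊆span p w w∈T)
    where
    open Plane p using (u; v)
    spanned : ∀ {w} → w ∈ (0v ∷ u ∷ v ∷ (u ⊕ v) ∷ []) → B w ≡ true
    spanned (here refl)                         = 0∈B
    spanned (there (here refl))                 = u∈B
    spanned (there (there (here refl)))         = v∈B
    spanned (there (there (there (here refl)))) = ⊕-closed u v u∈B v∈B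

module QuotientRing where
  open VectorSpace
  open import Data.Bool using (Bool; true; false; _xor_; _∧_)
  open import Data.Bool.Properties using (∧-distribʳ-xor)
  open import Data.Nat using (zero; suc; _≤_; z≤n; s≤s)
  open import Data.Empty using (⊥-elim)
  open import Relation.Nullary using (¬_)
  open import Data.Nat.Properties using (m≤n⇒m≤1+n; ≤-reflexive)
  open import Data.Vec using ([]; _∷_; init; last; toList)
  import Data.Vec as Vec
  open import Data.Vec.Properties using (length-toList)
  open import Data.List using (List; []; _∷_; foldr; length)
  open import Relation.Binary.PropositionalEquality using (_≡_; refl; sym; trans; cong; cong₂)
  open import Data.Product using (_,_)
  open Relation.Binary.PropositionalEquality.≡-Reasoning

  init-⊕ : ∀ {m} (u v : V (suc m)) → init (u ⊕ v) ≡ init u ⊕ init v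
  init-⊕ {zero}  (a ∷ []) (b ∷ []) = refl
  init-⊕ {suc m} (a ∷ u)  (b ∷ v)  = cong ((a xor b) ∷_) (init-⊕ u v)

  last-⊕ : ∀ {m} (u v : V (suc m)) → last (u ⊕ v) ≡ last u xor last v
  last-⊕ {zero}  (a ∷ []) (b ∷ []) = refl
  last-⊕ {suc m} (a ∷ u)  (b ∷ v)  = last-⊕ u v

  init-0 : ∀ m → init {n = m} (0v {suc m}) ≡ 0v
  init-0 zero    = refl
  init-0 (suc m) = cong (false ∷_) (init-0 m)

  last-0 : ∀ m → last {n = m} (0v {suc m}) ≡ false
  last-0 zero    = refl
  last-0 (suc m) = last-0 m

  map-∧-xor : ∀ {n} x y (f : V n) → Vec.map ((x xor y) ∧_) f ≡ Vec.map (x ∧_) f ⊕ Vec.map (y ∧_) f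
  map-∧-xor x y []      = refl
  map-∧-xor x y (c ∷ f) = cong₂ _∷_ (∧-distribʳ-xor c x y) (map-∧-xor x y f)

  map-false∧ : ∀ {n} (f : V n) → Vec.map (false ∧_) f ≡ 0v
  map-false∧ []      = refl
  map-false∧ (c ∷ f) = cong (false ∷_) (map-false∧ f)

  mulX-⊕ : ∀ {n} (f : V n) u v → mulX f (u ⊕ v) ≡ mulX f u ⊕ mulX f v
  mulX-⊕ {zero}  f [] [] = refl
  mulX-⊕ {suc m} f u v = begin
    (false ∷ init (u ⊕ v)) ⊕ Vec.map (last (u ⊕ v) ∧_) f
      ≡⟨ cong₂ (λ a b → (false ∷ a) ⊕ Vec.map (b ∧_) f) (init-⊕ u v) (last-⊕ u v) ⟩
    (false ∷ (init u ⊕ init v)) ⊕ Vec.map ((last u xor last v) ∧_) f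
      ≡⟨ cong ((false ∷ (init u ⊕ init v)) ⊕_) (map-∧-xor (last u) (last v) f) ⟩
    ((false ∷ init u) ⊕ (false ∷ init v)) ⊕ (Vec.map (last u ∧_) f ⊕ Vec.map (last v ∧_) f)
      ≡⟨ ⊕-interchange (false ∷ init u) (false ∷ init v) _ _ ⟩
    mulX f u ⊕ mulX f v ∎

  mulX-0 : ∀ {n} (f : V n) → mulX f 0v ≡ 0v
  mulX-0 {zero}  [] = refl
  mulX-0 {suc m} f = begin
    (false ∷ init (0v {suc m})) ⊕ Vec.map (last (0v {suc m}) ∧_) f
      ≡⟨ cong₂ (λ a b → (false ∷ a) ⊕ Vec.map (b ∧_) f) (init-0 m) (last-0 m) ⟩
    (false ∷ 0v) ⊕ Vec.map (false ∧_) f ≡⟨ cong ((false ∷ 0v) ⊕_) (map-false∧ f) ⟩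
    0v ⊕ 0v                             ≡⟨ ⊕-identityˡ 0v ⟩
    0v                                  ∎

  scale-⊕ : ∀ {n} b (u v : V n) → scale b (u ⊕ v) ≡ scale b u ⊕ scale b v
  scale-⊕ true  u v = refl
  scale-⊕ false u v = sym (⊕-identityˡ 0v)

  scale-0 : ∀ {n} b → scale b (0v {n}) ≡ 0v
  scale-0 true  = refl
  scale-0 false = refl

  mulX-scale : ∀ {n} (f : V n) b u → mulX f (scale b u) ≡ scale b (mulX f u)
  mulX-scale f true  u = refl
  mulX-scale f false u = mulX-0 f

  -- Horner's scheme: horner f a (b₀ ∷ … ∷ bₖ) = Σ bᵢ xⁱ a mod f, so that mul f a b = horner f a (toList b).
  horner : ∀ {n} (f : V n) → V n → List Bool → V n
  horner f a []       = 0v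
  horner f a (b ∷ bs) = mulX f (horner f a bs) ⊕ scale b a

  mul≡horner : ∀ {n} (f : V n) a b → mul f a b ≡ horner f a (toList b)
  mul≡horner f a b = go (toList b)
    where
    go : ∀ bs → foldr (λ bi acc → mulX f acc ⊕ scale bi a) 0v bs ≡ horner f a bs
    go []       = refl
    go (b ∷ bs) = cong (λ z → mulX f z ⊕ scale b a) (go bs)

  -- horner f a bs is linear in a and commutes with multiplication by x …
  horner-⊕ : ∀ {n} (f : V n) a a' bs → horner f (a ⊕ a') bs ≡ horner f a bs ⊕ horner f a' bs
  horner-⊕ f a a' []       = sym (⊕-identityˡ 0v)
  horner-⊕ f a a' (b ∷ bs) = begin
    mulX f (horner f (a ⊕ a') bs) ⊕ scale b (a ⊕ a')
      ≡⟨ cong₂ (λ p q → mulX f p ⊕ q) (horner-⊕ f a a' bs) (scale-⊕ b a a') ⟩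
    mulX f (horner f a bs ⊕ horner f a' bs) ⊕ (scale b a ⊕ scale b a')
      ≡⟨ cong (_⊕ (scale b a ⊕ scale b a')) (mulX-⊕ f _ _) ⟩
    (mulX f (horner f a bs) ⊕ mulX f (horner f a' bs)) ⊕ (scale b a ⊕ scale b a')
      ≡⟨ ⊕-interchange _ _ _ _ ⟩
    horner f a (b ∷ bs) ⊕ horner f a' (b ∷ bs) ∎

  horner-0 : ∀ {n} (f : V n) bs → horner f 0v bs ≡ 0v
  horner-0 f []       = refl
  horner-0 f (b ∷ bs) = begin
    mulX f (horner f 0v bs) ⊕ scale b 0v ≡⟨ cong₂ (λ p q → mulX f p ⊕ q) (horner-0 f bs) (scale-0 b) ⟩
    mulX f 0v ⊕ 0v                       ≡⟨ cong (_⊕ 0v) (mulX-0 f) ⟩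
    0v ⊕ 0v                              ≡⟨ ⊕-identityˡ 0v ⟩
    0v                                   ∎

  horner-scale : ∀ {n} (f : V n) c a bs → horner f (scale c a) bs ≡ scale c (horner f a bs)
  horner-scale f true  a bs = refl
  horner-scale f false a bs = horner-0 f bs

  mulX-horner : ∀ {n} (f : V n) a bs → mulX f (horner f a bs) ≡ horner f (mulX f a) bs
  mulX-horner f a []       = mulX-0 f
  mulX-horner f a (b ∷ bs) = begin
    mulX f (mulX f (horner f a bs) ⊕ scale b a)            ≡⟨ mulX-⊕ f _ _ ⟩
    mulX f (mulX f (horner f a bs)) ⊕ mulX f (scale b a)
      ≡⟨ cong₂ (λ p q → mulX f p ⊕ q) (mulX-horner f a bs) (mulX-scale f b a) ⟩
    horner f (mulX f a) (b ∷ bs)                           ∎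

  -- … hence any two Horner operators commute; this is the heart of commutativity and associativity.
  horner-comm : ∀ {n} (f : V n) a bs cs → horner f (horner f a cs) bs ≡ horner f (horner f a bs) cs
  horner-comm f a bs []       = horner-0 f bs
  horner-comm f a bs (c ∷ cs) = begin
    horner f (mulX f (horner f a cs) ⊕ scale c a) bs
      ≡⟨ horner-⊕ f _ _ bs ⟩
    horner f (mulX f (horner f a cs)) bs ⊕ horner f (scale c a) bs
      ≡⟨ cong₂ _⊕_ (sym (mulX-horner f (horner f a cs) bs)) (horner-scale f c a bs) ⟩
    mulX f (horner f (horner f a cs) bs) ⊕ scale c (horner f a bs)
      ≡⟨ cong (λ z → mulX f z ⊕ scale c (horner f a bs)) (horner-comm f a bs cs) ⟩
    horner f (horner f a bs) (c ∷ cs) ∎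

  pad : ∀ {n} → List Bool → V n
  pad {zero}  _        = []
  pad {suc m} []       = 0v
  pad {suc m} (b ∷ bs) = b ∷ pad {m} bs

  pad-toList : ∀ {n} (v : V n) → pad (toList v) ≡ v
  pad-toList []      = refl
  pad-toList (b ∷ v) = cong (b ∷_) (pad-toList v)

  last-pad : ∀ m bs → length bs ≤ m → last (pad {suc m} bs) ≡ false
  last-pad zero    []       _       = refl
  last-pad (suc m) []       _       = last-0 (suc m)
  last-pad (suc m) (b ∷ bs) (s≤s l) = last-pad m bs l

  init-pad : ∀ m bs → length bs ≤ m → init (pad {suc m} bs) ≡ pad {m} bs
  init-pad zero    []       _       = refl
  init-pad (suc m) []       _       = init-0 (suc m)
  init-pad (suc m) (b ∷ bs) (s≤s l) = cong (b ∷_) (init-pad m bs l)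

  -- Multiplying 1 by a polynomial of degree < n involves no reduction modulo f.
  horner-one : ∀ {n} (f : V n) bs → length bs ≤ n → horner f (one n) bs ≡ pad bs
  horner-one {zero}  f []       _       = refl
  horner-one {suc m} f []       _       = refl
  horner-one {suc m} f (b ∷ bs) (s≤s l) = begin
    mulX f (horner f (one (suc m)) bs) ⊕ scale b (one (suc m))
      ≡⟨ cong (λ z → mulX f z ⊕ scale b (one (suc m))) (horner-one f bs (m≤n⇒m≤1+n l)) ⟩
    ((false ∷ init (pad {suc m} bs)) ⊕ Vec.map (last (pad {suc m} bs) ∧_) f) ⊕ scale b (one (suc m))
      ≡⟨ cong₂ (λ p q → ((false ∷ p) ⊕ Vec.map (q ∧_) f) ⊕ scale b (one (suc m))) (init-pad m bs l) (last-pad m bs l) ⟩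
    ((false ∷ pad {m} bs) ⊕ Vec.map (false ∧_) f) ⊕ scale b (one (suc m))
      ≡⟨ cong (λ z → ((false ∷ pad {m} bs) ⊕ z) ⊕ scale b (one (suc m))) (map-false∧ f) ⟩
    ((false ∷ pad {m} bs) ⊕ 0v) ⊕ scale b (one (suc m))
      ≡⟨ cong (_⊕ scale b (one (suc m))) (⊕-identityʳ _) ⟩
    (false ∷ pad {m} bs) ⊕ scale b (one (suc m))
      ≡⟨ add-constant b ⟩
    b ∷ pad {m} bs ∎
    where
    add-constant : ∀ b → (false ∷ pad {m} bs) ⊕ scale b (one (suc m)) ≡ b ∷ pad {m} bs
    add-constant true  = cong (true ∷_) (⊕-identityʳ _)
    add-constant false = ⊕-identityʳ _

  horner-one-toList : ∀ {n} (f : V n) (b : V n) → horner f (one n) (toList b) ≡ b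
  horner-one-toList f b = trans (horner-one f (toList b) (≤-reflexive (length-toList b))) (pad-toList b)

  nonzero⇒1≤n : ∀ {n} (a : V n) → ¬ (a ≡ 0v) → 1 ≤ n
  nonzero⇒1≤n {zero}  [] a≢0 = ⊥-elim (a≢0 refl)
  nonzero⇒1≤n {suc m} a  _   = s≤s z≤n

  one≢0 : ∀ {n} → 1 ≤ n → ¬ (one n ≡ 0v)
  one≢0 {suc m} _ ()

  module RingLaws {n} (f : V n) where

    infixl 7 _·_
    _·_ : V n → V n → V n
    a · b = mul f a b

    1v : V n
    1v = one n

    ·-identityˡ : ∀ b → 1v · b ≡ b
    ·-identityˡ b = trans (mul≡horner f 1v b) (horner-one-toList f b)

    as-horner : ∀ a → a ≡ horner f 1v (toList a)
    as-horner a = sym (horner-one-toList f a)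

    ·-comm : ∀ a b → a · b ≡ b · a
    ·-comm a b = begin
      a · b                                    ≡⟨ mul≡horner f a b ⟩
      horner f a (toList b)                    ≡⟨ cong (λ z → horner f z (toList b)) (as-horner a) ⟩
      horner f (horner f 1v (toList a)) (toList b) ≡⟨ horner-comm f 1v (toList b) (toList a) ⟩
      horner f (horner f 1v (toList b)) (toList a) ≡⟨ cong (λ z → horner f z (toList a)) (sym (as-horner b)) ⟩
      horner f b (toList a)                    ≡⟨ sym (mul≡horner f b a) ⟩
      b · a                                    ∎

    ·-identityʳ : ∀ a → a · 1v ≡ a
    ·-identityʳ a = trans (·-comm a 1v) (·-identityˡ a)

    ·-zeroˡ : ∀ b → 0v · b ≡ 0v
    ·-zeroˡ b = trans (mul≡horner f 0v b) (horner-0 f (toList b))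

    ·-zeroʳ : ∀ a → a · 0v ≡ 0v
    ·-zeroʳ a = trans (·-comm a 0v) (·-zeroˡ a)

    ·-distribʳ-⊕ : ∀ a a' b → (a ⊕ a') · b ≡ (a · b) ⊕ (a' · b)
    ·-distribʳ-⊕ a a' b = begin
      (a ⊕ a') · b                               ≡⟨ mul≡horner f _ b ⟩
      horner f (a ⊕ a') (toList b)               ≡⟨ horner-⊕ f a a' (toList b) ⟩
      horner f a (toList b) ⊕ horner f a' (toList b) ≡⟨ sym (cong₂ _⊕_ (mul≡horner f a b) (mul≡horner f a' b)) ⟩
      (a · b) ⊕ (a' · b)                         ∎

    ·-distribˡ-⊕ : ∀ a b b' → a · (b ⊕ b') ≡ (a · b) ⊕ (a · b')
    ·-distribˡ-⊕ a b b' = trans (·-comm a _) (trans (·-distribʳ-⊕ b b' a) (cong₂ _⊕_ (·-comm b a) (·-comm b' a)))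

    ·-assoc : ∀ a b c → (a · b) · c ≡ a · (b · c)
    ·-assoc a b c = begin
      (a · b) · c                        ≡⟨ mul≡horner f _ c ⟩
      horner f (a · b) C                 ≡⟨ cong (λ z → horner f z C) (trans (mul≡horner f a b) (cong (λ z → horner f z B) (as-horner a))) ⟩
      horner f (horner f (horner f 1v A) B) C ≡⟨ cong (λ z → horner f z C) (horner-comm f 1v B A) ⟩
      horner f (horner f (horner f 1v B) A) C ≡⟨ horner-comm f (horner f 1v B) C A ⟩
      horner f (horner f (horner f 1v B) C) A ≡⟨ cong (λ z → horner f (horner f z C) A) (sym (as-horner b)) ⟩
      horner f (horner f b C) A          ≡⟨ cong (λ z → horner f z A) (sym (mul≡horner f b c)) ⟩
      horner f (b · c) A                 ≡⟨ sym (mul≡horner f _ a) ⟩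
      (b · c) · a                        ≡⟨ ·-comm _ a ⟩
      a · (b · c)                        ∎
      where
      A = toList a
      B = toList b
      C = toList c

  -- For n ≥ 2 the powers of 0 are 1 and 0, which miss the element x; so a primitive element is nonzero.
  primitive≢0 : ∀ {n} (f α : V n) → 2 ≤ n → IsPrimitive f α → ¬ (α ≡ 0v)
  primitive≢0 {suc zero}    f α (s≤s ()) _ _
  primitive≢0 {suc (suc m)} f α _ α-primitive α≡0 with α-primitive (false ∷ true ∷ 0v) (λ ())
  ... | zero  , _ , ()
  ... | suc j , _ , αʲ⁺¹≡x = 0≢x (trans (sym (trans (cong (λ a → mul f a (pow f α j)) α≡0) (RingLaws.·-zeroˡ f (pow f α j)))) αʲ⁺¹≡x)
    where
    0≢x : ¬ (0v ≡ false ∷ true ∷ 0v)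
    0≢x ()

module NumberTheory where
  open import Data.Nat using (ℕ; zero; suc; _+_; _*_; _∸_; _^_; _≤_; _<_; z≤n; s≤s; _%_)
  open import Data.Nat.Properties
  open import Data.Nat.DivMod
  open import Data.Nat.Divisibility
  open import Data.Nat.Coprimality using (Coprime; coprime-divisor; coprime-Bézout; prime⇒coprime)
  open import Data.Nat.GCD using (module Bézout)
  open import Data.Nat.Primality using (Prime; prime⇒nonTrivial)
  import Data.Nat.Base as ℕ
  open import Data.Nat.Tactic.RingSolver using (solve-∀)
  open import Data.Empty using (⊥; ⊥-elim)
  open import Data.Product using (_,_)
  open import Relation.Nullary using (¬_)
  open import Relation.Binary.Definitions using (tri<; tri≈; tri>)
  open import Relation.Binary.PropositionalEquality using (_≡_; refl; sym; trans; cong; cong₂; subst)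
  open import Relation.Binary.PropositionalEquality using (module ≡-Reasoning)
  open import Relation.Binary.Bundles using (Setoid)
  import Relation.Binary.Reasoning.Setoid
  open import Level using (0ℓ)

  prime⇒1<n : ∀ {n} → Prime n → 1 < n
  prime⇒1<n {n} n-prime = ℕ.nonTrivial⇒n>1 n {{prime⇒nonTrivial n-prime}}

  2^≡suc : ∀ a → 2 ^ a ≡ suc (2 ^ a ∸ 1)
  2^≡suc a = sym (trans (+-comm 1 (2 ^ a ∸ 1)) (m∸n+n≡m (m^n>0 2 a)))

  mersenne≡suc : ∀ n → 1 ≤ n → 2 ^ n ∸ 1 ≡ suc (2 ^ n ∸ 2)
  mersenne≡suc (suc n) _ = ∸1≡suc∸2 (*-monoʳ-≤ 2 (m^n>0 2 n))
    where
    ∸1≡suc∸2 : ∀ {m} → 2 ≤ m → m ∸ 1 ≡ suc (m ∸ 2)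
    ∸1≡suc∸2 {suc zero}    (s≤s ())
    ∸1≡suc∸2 {suc (suc m)} _ = refl

  mersenne-+ : ∀ a c → 2 ^ (a + c) ∸ 1 ≡ 2 ^ c * (2 ^ a ∸ 1) + (2 ^ c ∸ 1)
  mersenne-+ a c = begin
    2 ^ (a + c) ∸ 1                             ≡⟨ cong (_∸ 1) (^-distribˡ-+-* 2 a c) ⟩
    2 ^ a * 2 ^ c ∸ 1                           ≡⟨ cong₂ (λ x y → x * y ∸ 1) (2^≡suc a) (2^≡suc c) ⟩
    suc (2 ^ a ∸ 1) * suc (2 ^ c ∸ 1) ∸ 1       ≡⟨ cong (_∸ 1) (expand (2 ^ a ∸ 1) (2 ^ c ∸ 1)) ⟩
    suc (2 ^ c ∸ 1) * (2 ^ a ∸ 1) + (2 ^ c ∸ 1) ≡⟨ cong (λ x → x * (2 ^ a ∸ 1) + (2 ^ c ∸ 1)) (sym (2^≡suc c)) ⟩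
    2 ^ c * (2 ^ a ∸ 1) + (2 ^ c ∸ 1)           ∎
    where
    open ≡-Reasoning
    expand : ∀ A C → suc A * suc C ≡ suc (suc C * A + C)
    expand = solve-∀

  module MersenneDivisors (d : ℕ) where

    Divides2^-1 : ℕ → Set
    Divides2^-1 a = d ∣ 2 ^ a ∸ 1

    ∣2^-1-+ : ∀ a c → Divides2^-1 a → Divides2^-1 c → Divides2^-1 (a + c)
    ∣2^-1-+ a c da dc = subst (d ∣_) (sym (mersenne-+ a c)) (∣m∣n⇒∣m+n (∣n⇒∣m*n (2 ^ c) da) dc)

    ∣2^-1-∸ : ∀ a c → Divides2^-1 a → Divides2^-1 (a + c) → Divides2^-1 c
    ∣2^-1-∸ a c da dac = ∣m+n∣m⇒∣n (subst (d ∣_) (mersenne-+ a c) dac) (∣n⇒∣m*n (2 ^ c) da)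

    ∣2^-1-* : ∀ a x → Divides2^-1 a → Divides2^-1 (x * a)
    ∣2^-1-* a zero    da = d ∣0
    ∣2^-1-* a (suc x) da = ∣2^-1-+ a (x * a) da (∣2^-1-* a x da)

  -- gcd(k, n) = 1 implies gcd(2^k - 1, 2^n - 1) = 1, via a Bézout identity between k and n.
  coprime-mersenne : ∀ {k n} → Coprime k n → Coprime (2 ^ k ∸ 1) (2 ^ n ∸ 1)
  coprime-mersenne {k} {n} c {d} (dk , dn) with coprime-Bézout c
  ... | Bézout.+- x y eq = ∣1⇒≡1 (∣2^-1-∸ (y * n) 1 (∣2^-1-* n y dn)
          (subst Divides2^-1 (trans (sym eq) (+-comm 1 (y * n))) (∣2^-1-* k x dk)))
    where open MersenneDivisors d
  ... | Bézout.-+ x y eq = ∣1⇒≡1 (∣2^-1-∸ (x * k) 1 (∣2^-1-* k x dk)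
          (subst Divides2^-1 (trans (sym eq) (+-comm 1 (x * k))) (∣2^-1-* n y dn)))
    where open MersenneDivisors d

  -- 2^n - 1 is odd for n ≥ 1, hence multiplication by powers of 2 can be cancelled modulo it.
  2∤odd : ∀ m → ¬ (2 ∣ 2 * m + 1)
  2∤odd m d with ∣m+n∣m⇒∣n d (m∣m*n m)
  ... | divides zero    ()
  ... | divides (suc zero) ()
  ... | divides (suc (suc q)) ()

  coprime-mersenne-2 : ∀ n → 1 ≤ n → Coprime (2 ^ n ∸ 1) 2
  coprime-mersenne-2 (suc n) _ {zero} (_ , d∣2) with 0∣⇒≡0 d∣2
  ... | ()
  coprime-mersenne-2 (suc n) _ {suc zero} _ = refl
  coprime-mersenne-2 (suc n) _ {suc (suc (suc d))} (_ , d∣2) with ∣⇒≤ d∣2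
  ... | s≤s (s≤s ())
  coprime-mersenne-2 (suc n) _ {suc (suc zero)} (2∣N , _) = ⊥-elim (2∤odd (2 ^ n ∸ 1) (subst (2 ∣_) odd 2∣N))
    where
    open ≡-Reasoning
    odd : 2 * 2 ^ n ∸ 1 ≡ 2 * (2 ^ n ∸ 1) + 1
    odd = begin
      2 * 2 ^ n ∸ 1             ≡⟨ cong (λ x → 2 * x ∸ 1) (2^≡suc n) ⟩
      2 * suc (2 ^ n ∸ 1) ∸ 1   ≡⟨ cong (_∸ 1) (*-suc 2 (2 ^ n ∸ 1)) ⟩
      2 + 2 * (2 ^ n ∸ 1) ∸ 1   ≡⟨ +-comm 1 _ ⟩
      2 * (2 ^ n ∸ 1) + 1       ∎

  ∣2^*⇒∣ : ∀ {M} → Coprime M 2 → ∀ i δ → M ∣ 2 ^ i * δ → M ∣ δ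
  ∣2^*⇒∣ {M} c zero    δ d = subst (M ∣_) (+-identityʳ δ) d
  ∣2^*⇒∣ {M} c (suc i) δ d = ∣2^*⇒∣ c i δ (coprime-divisor c (subst (M ∣_) (*-assoc 2 (2 ^ i) δ) d))

  -- Congruence modulo N = suc N' (a positive modulus).  It is a record, so that the two sides are
  -- recoverable from a proof and implicit arguments of the lemmas below can be inferred.
  module Congruence (N' : ℕ) where

    N : ℕ
    N = suc N'

    infix 4 _≈_
    record _≈_ (x y : ℕ) : Set where
      constructor mod-eq
      field mod-≡ : x % N ≡ y % N
    open _≈_ public

    ≈-refl : ∀ {x} → x ≈ x
    ≈-refl = mod-eq refl

    ≈-sym : ∀ {x y} → x ≈ y → y ≈ x
    ≈-sym (mod-eq e) = mod-eq (sym e)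

    ≈-trans : ∀ {x y z} → x ≈ y → y ≈ z → x ≈ z
    ≈-trans (mod-eq e₁) (mod-eq e₂) = mod-eq (trans e₁ e₂)

    ≡⇒≈ : ∀ {x y} → x ≡ y → x ≈ y
    ≡⇒≈ refl = ≈-refl

    ≈-setoid : Setoid 0ℓ 0ℓ
    ≈-setoid = record { Carrier = ℕ ; _≈_ = _≈_
                      ; isEquivalence = record { refl = ≈-refl ; sym = ≈-sym ; trans = ≈-trans } }

    module ≈-Reasoning = Relation.Binary.Reasoning.Setoid ≈-setoid

    ≈-+ : ∀ {a b c d} → a ≈ b → c ≈ d → a + c ≈ b + d
    ≈-+ {a} {b} {c} {d} (mod-eq e₁) (mod-eq e₂) = mod-eq (begin
      (a + c) % N           ≡⟨ %-distribˡ-+ a c N ⟩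
      (a % N + c % N) % N   ≡⟨ cong₂ (λ x y → (x + y) % N) e₁ e₂ ⟩
      (b % N + d % N) % N   ≡⟨ sym (%-distribˡ-+ b d N) ⟩
      (b + d) % N           ∎)
      where open ≡-Reasoning

    ≈-* : ∀ {a b c d} → a ≈ b → c ≈ d → a * c ≈ b * d
    ≈-* {a} {b} {c} {d} (mod-eq e₁) (mod-eq e₂) = mod-eq (begin
      (a * c) % N               ≡⟨ %-distribˡ-* a c N ⟩
      (a % N * (c % N)) % N     ≡⟨ cong₂ (λ x y → (x * y) % N) e₁ e₂ ⟩
      (b % N * (d % N)) % N     ≡⟨ sym (%-distribˡ-* b d N) ⟩
      (b * d) % N               ∎)
      where open ≡-Reasoning

    ≈-+ˡ : ∀ a {c d} → c ≈ d → a + c ≈ a + d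
    ≈-+ˡ a = ≈-+ (≈-refl {a})

    ≈-+ʳ : ∀ {a b} c → a ≈ b → a + c ≈ b + c
    ≈-+ʳ c e = ≈-+ e (≈-refl {c})

    ≈-*ˡ : ∀ a {c d} → c ≈ d → a * c ≈ a * d
    ≈-*ˡ a = ≈-* (≈-refl {a})

    ≈-*ʳ : ∀ {a b} c → a ≈ b → a * c ≈ b * c
    ≈-*ʳ c e = ≈-* e (≈-refl {c})

    ≈-% : ∀ x → x % N ≈ x
    ≈-% x = mod-eq (m%n%n≡m%n x N)

    ≈-+*N : ∀ a c → a + c * N ≈ a
    ≈-+*N a c = mod-eq ([m+kn]%n≡m%n a c N)

    ≈-cancelʳ : ∀ {a b} c → a + c ≈ b + c → a ≈ b
    ≈-cancelʳ {a} {b} c e = begin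
      a                    ≈⟨ ≈-sym (≈-+*N a c) ⟩
      a + c * N            ≡⟨ regroup a ⟩
      (a + c) + c * N'     ≈⟨ ≈-+ʳ (c * N') e ⟩
      (b + c) + c * N'     ≡⟨ sym (regroup b) ⟩
      b + c * N            ≈⟨ ≈-+*N b c ⟩
      b                    ∎
      where
      open ≈-Reasoning
      regroup : ∀ x → x + c * N ≡ (x + c) + c * N'
      regroup x = trans (cong (x +_) (*-suc c N')) (sym (+-assoc x c (c * N')))

    ≈-cancelˡ : ∀ a {c d} → a + c ≈ a + d → c ≈ d
    ≈-cancelˡ a {c} {d} e = ≈-cancelʳ a (≈-trans (≡⇒≈ (+-comm c a)) (≈-trans e (≡⇒≈ (+-comm a d))))

    -- subtraction modulo N: a ⊖ X is the residue t < N with t + X ≡ a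
    _⊖_ : ℕ → ℕ → ℕ
    a ⊖ X = (a + N' * X) % N

    ⊖<N : ∀ a X → a ⊖ X < N
    ⊖<N a X = m%n<n (a + N' * X) N

    ⊖-+ : ∀ a X → a ⊖ X + X ≈ a
    ⊖-+ a X = begin
      (a + N' * X) % N + X      ≈⟨ ≈-+ʳ X (≈-% (a + N' * X)) ⟩
      (a + N' * X) + X          ≡⟨ regroup a N' X ⟩
      a + X * N                 ≈⟨ ≈-+*N a X ⟩
      a                         ∎
      where
      open ≈-Reasoning
      regroup : ∀ a N' X → (a + N' * X) + X ≡ a + X * suc N'
      regroup = solve-∀

    ≈⇒≡ : ∀ {a b} → a < N → b < N → a ≈ b → a ≡ b
    ≈⇒≡ a<N b<N (mod-eq e) = trans (sym (m<n⇒m%n≡m a<N)) (trans e (m<n⇒m%n≡m b<N))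

    ≈0⇒∣ : ∀ {x} → x ≈ 0 → N ∣ x
    ≈0⇒∣ {x} (mod-eq e) = m%n≡0⇒n∣m x N e

    ∣⇒≈0 : ∀ {x} → N ∣ x → x ≈ 0
    ∣⇒≈0 {x} d = mod-eq (n∣m⇒m%n≡0 x N d)

  -- For n prime and N = 2^n - 1, the n residues 2^i δ (i < n) of any δ ≢ 0 (mod N) are distinct:
  -- 2^i δ ≡ 2^j δ with i < j gives N ∣ (2^(j-i) - 1) 2^i δ, and gcd(2^(j-i) - 1, N) = 1.
  module Doubling (n N' : ℕ) (N≡ : 2 ^ n ∸ 1 ≡ suc N') (n-prime : Prime n) where
    open Congruence N'

    private
      doubling-injective-< : ∀ δ → ¬ (N ∣ δ) → ∀ i j → i < j → j < n → 2 ^ i * δ ≈ 2 ^ j * δ → ⊥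
      doubling-injective-< δ N∤δ i j i<j j<n e = N∤δ (∣2^*⇒∣ N-odd i δ (coprime-divisor N⊥m N∣mX))
        where
        k : ℕ
        k = j ∸ suc i
        j≡ : i + suc k ≡ j
        j≡ = trans (+-suc i k) (m+[n∸m]≡n i<j)
        k<n : suc k < n
        k<n = ≤-<-trans (subst (suc k ≤_) j≡ (m≤n+m (suc k) i)) j<n
        X m : ℕ
        X = 2 ^ i * δ
        m = 2 ^ suc k ∸ 1
        N⊥m : Coprime N m
        N⊥m = subst (λ z → Coprime z m) N≡ (coprime-mersenne (prime⇒coprime n-prime k<n))
        N-odd : Coprime N 2
        N-odd = subst (λ z → Coprime z 2) N≡ (coprime-mersenne-2 n (≤-trans (s≤s z≤n) j<n))
        2^jδ≡ : 2 ^ j * δ ≡ X + m * X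
        2^jδ≡ = let open ≡-Reasoning in begin
          2 ^ j * δ               ≡⟨ cong (λ z → 2 ^ z * δ) (sym j≡) ⟩
          2 ^ (i + suc k) * δ     ≡⟨ cong (_* δ) (^-distribˡ-+-* 2 i (suc k)) ⟩
          2 ^ i * 2 ^ suc k * δ   ≡⟨ cong (_* δ) (*-comm (2 ^ i) (2 ^ suc k)) ⟩
          2 ^ suc k * 2 ^ i * δ   ≡⟨ *-assoc (2 ^ suc k) (2 ^ i) δ ⟩
          2 ^ suc k * X           ≡⟨ cong (_* X) (2^≡suc (suc k)) ⟩
          suc m * X               ∎
        0+X≈mX+X : 0 + X ≈ m * X + X
        0+X≈mX+X = ≈-trans e (≡⇒≈ (trans 2^jδ≡ (+-comm X (m * X))))
        N∣mX : N ∣ m * X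
        N∣mX = ≈0⇒∣ (≈-sym (≈-cancelʳ X 0+X≈mX+X))

    doubling-injective : ∀ δ → ¬ (N ∣ δ) → ∀ i j → i < n → j < n → 2 ^ i * δ ≈ 2 ^ j * δ → i ≡ j
    doubling-injective δ N∤δ i j i<n j<n e with <-cmp i j
    ... | tri< i<j _ _ = ⊥-elim (doubling-injective-< δ N∤δ i j i<j j<n e)
    ... | tri≈ _ i≡j _ = i≡j
    ... | tri> _ _ j<i = ⊥-elim (doubling-injective-< δ N∤δ j i j<i i<n (≈-sym e))

module CyclotomicCosets (n N' : ℕ) (N≡ : ordN n ≡ suc N') (n>0 : 0 < n) where
  open NumberTheory
  open import Data.Nat using (zero; _+_; _*_; _∸_; _^_; _≤_; _%_; _/_; _⊓_; NonZero)
  import Data.Nat.Base as ℕ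
  open import Data.Nat.Properties
  open import Data.Nat.DivMod using (m≡m%n+[m/n]*n; m%n<n; [m+n]%n≡m%n)
  open import Data.Nat.Divisibility using (_∣_)
  open import Data.Nat.Coprimality using (Coprime)
  open import Data.List using ([]; _∷_; foldr; map; upTo)
  open import Data.List.Properties using (map-cong)
  open import Data.List.Membership.Propositional using (_∈_)
  open import Data.List.Membership.Propositional.Properties using (∈-map⁺; ∈-map⁻; ∈-upTo⁺; ∈-upTo⁻)
  open import Data.List.Relation.Unary.Any using (here; there)
  open import Data.Product using (_,_; _×_; ∃)
  open import Data.Sum using (_⊎_; inj₁; inj₂)
  open import Data.Nat.Tactic.RingSolver using (solve-∀)
  open import Relation.Nullary using (¬_)
  open import Relation.Binary.PropositionalEquality using (refl; sym; trans; cong; cong₂; subst; module ≡-Reasoning)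

  open Congruence N' public

  instance
    n-nonZero : NonZero n
    n-nonZero = ℕ.>-nonZero n>0

  modN≡% : ∀ x → modN x (ordN n) ≡ x % N
  modN≡% x = cong (modN x) N≡

  cosetMin≡ : ∀ s → cosetMin n s ≡ foldr _⊓_ (s % N) (map (λ i → (s * 2 ^ i) % N) (upTo n))
  cosetMin≡ s = cong₂ (foldr _⊓_) (modN≡% s) (map-cong (λ i → modN≡% (s * 2 ^ i)) (upTo n))

  foldr-⊓-≤ : ∀ z {x} xs → x ∈ xs → foldr _⊓_ z xs ≤ x
  foldr-⊓-≤ z (y ∷ xs) (here refl) = m⊓n≤m y _
  foldr-⊓-≤ z (y ∷ xs) (there m)   = ≤-trans (m⊓n≤n y _) (foldr-⊓-≤ z xs m)

  foldr-⊓-sel : ∀ z xs → (foldr _⊓_ z xs ≡ z) ⊎ (foldr _⊓_ z xs ∈ xs)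
  foldr-⊓-sel z []       = inj₁ refl
  foldr-⊓-sel z (y ∷ xs) with ⊓-sel y (foldr _⊓_ z xs)
  ... | inj₁ e = inj₂ (here e)
  ... | inj₂ e with foldr-⊓-sel z xs
  ...   | inj₁ e' = inj₁ (trans e e')
  ...   | inj₂ m  = inj₂ (there (subst (_∈ xs) (sym e) m))

  cosetMin-≤ : ∀ s i → i < n → cosetMin n s ≤ (s * 2 ^ i) % N
  cosetMin-≤ s i i<n = subst (_≤ _) (sym (cosetMin≡ s)) (foldr-⊓-≤ _ _ (∈-map⁺ (λ i → (s * 2 ^ i) % N) (∈-upTo⁺ i<n)))

  cosetMin-attained : ∀ s → ∃ λ j → j < n × cosetMin n s ≡ (s * 2 ^ j) % N
  cosetMin-attained s with foldr-⊓-sel (s % N) (map (λ i → (s * 2 ^ i) % N) (upTo n))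
  ... | inj₁ e = 0 , n>0 , trans (cosetMin≡ s) (trans e (cong (_% N) (sym (*-identityʳ s))))
  ... | inj₂ m with ∈-map⁻ (λ i → (s * 2 ^ i) % N) m
  ...   | j , j∈ , e = j , ∈-upTo⁻ j∈ , trans (cosetMin≡ s) e

  2^n≈1 : 2 ^ n ≈ 1
  2^n≈1 = mod-eq (begin
    2 ^ n % N        ≡⟨ cong (_% N) (trans (sym (m∸n+n≡m (m^n>0 2 n))) (cong (_+ 1) N≡)) ⟩
    (N + 1) % N      ≡⟨ cong (_% N) (+-comm N 1) ⟩
    (1 + N) % N      ≡⟨ [m+n]%n≡m%n 1 N ⟩
    1 % N            ∎)
    where open ≡-Reasoning

  2^qn≈1 : ∀ q → 2 ^ (q * n) ≈ 1
  2^qn≈1 zero    = ≈-refl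
  2^qn≈1 (suc q) = ≈-trans (≡⇒≈ (^-distribˡ-+-* 2 n (q * n))) (≈-* 2^n≈1 (2^qn≈1 q))

  2^≈2^% : ∀ i → 2 ^ i ≈ 2 ^ (i % n)
  2^≈2^% i = begin
    2 ^ i                              ≡⟨ cong (2 ^_) (m≡m%n+[m/n]*n i n) ⟩
    2 ^ (i % n + (i / n) * n)          ≡⟨ ^-distribˡ-+-* 2 (i % n) _ ⟩
    2 ^ (i % n) * 2 ^ ((i / n) * n)    ≈⟨ ≈-*ˡ (2 ^ (i % n)) (2^qn≈1 (i / n)) ⟩
    2 ^ (i % n) * 1                    ≡⟨ *-identityʳ (2 ^ (i % n)) ⟩
    2 ^ (i % n)                        ∎
    where open ≈-Reasoning

  *2^-+ : ∀ s i j → s * 2 ^ i * 2 ^ j ≡ s * 2 ^ (i + j)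
  *2^-+ s i j = trans (*-assoc s (2 ^ i) (2 ^ j)) (cong (s *_) (sym (^-distribˡ-+-* 2 i j)))

  infix 4 _~_
  record _~_ (s s' : ℕ) : Set where
    constructor coset-step
    field
      exponent : ℕ
      s'≈      : s' ≈ s * 2 ^ exponent

  ~-trans : ∀ {a b c} → a ~ b → b ~ c → a ~ c
  ~-trans {a} (coset-step i b≈) (coset-step j c≈) = coset-step (i + j) (≈-trans c≈ (≈-trans (≈-*ʳ (2 ^ j) b≈) (≡⇒≈ (*2^-+ a i j))))

  -- 2^(i(n-1)) is an inverse of 2ⁱ modulo N, since 2^(in) ≡ 1.
  2^-inverse : ∀ i → 2 ^ i * 2 ^ (i * (n ∸ 1)) ≈ 1
  2^-inverse i = begin
    2 ^ i * 2 ^ (i * (n ∸ 1))   ≡⟨ sym (^-distribˡ-+-* 2 i _) ⟩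
    2 ^ (i + i * (n ∸ 1))       ≡⟨ cong (2 ^_) i+i[n-1]≡ ⟩
    2 ^ (i * n)                 ≈⟨ 2^qn≈1 i ⟩
    1                           ∎
    where
    open ≈-Reasoning
    i+i[n-1]≡ : i + i * (n ∸ 1) ≡ i * n
    i+i[n-1]≡ = trans (sym (*-suc i (n ∸ 1))) (cong (i *_) (trans (+-comm 1 (n ∸ 1)) (m∸n+n≡m n>0)))

  2^*-cancelˡ : ∀ i {a b} → 2 ^ i * a ≈ 2 ^ i * b → a ≈ b
  2^*-cancelˡ i {a} {b} e = ≈-trans (≈-sym (undo a)) (≈-trans (≈-*ˡ (2 ^ (i * (n ∸ 1))) e) (undo b))
    where
    undo : ∀ x → 2 ^ (i * (n ∸ 1)) * (2 ^ i * x) ≈ x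
    undo x = begin
      2 ^ (i * (n ∸ 1)) * (2 ^ i * x)   ≡⟨ sym (*-assoc (2 ^ (i * (n ∸ 1))) (2 ^ i) x) ⟩
      2 ^ (i * (n ∸ 1)) * 2 ^ i * x     ≡⟨ cong (_* x) (*-comm (2 ^ (i * (n ∸ 1))) (2 ^ i)) ⟩
      2 ^ i * 2 ^ (i * (n ∸ 1)) * x     ≈⟨ ≈-*ʳ x (2^-inverse i) ⟩
      1 * x                             ≡⟨ *-identityˡ x ⟩
      x                                 ∎
      where open ≈-Reasoning

  ~-sym : ∀ {a b} → a ~ b → b ~ a
  ~-sym {a} {b} (coset-step i b≈) = coset-step (i * (n ∸ 1)) (≈-sym (begin
    b * 2 ^ (i * (n ∸ 1))            ≈⟨ ≈-*ʳ (2 ^ (i * (n ∸ 1))) b≈ ⟩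
    a * 2 ^ i * 2 ^ (i * (n ∸ 1))    ≡⟨ *-assoc a (2 ^ i) _ ⟩
    a * (2 ^ i * 2 ^ (i * (n ∸ 1)))  ≈⟨ ≈-*ˡ a (2^-inverse i) ⟩
    a * 1                            ≡⟨ *-identityʳ a ⟩
    a                                ∎))
    where open ≈-Reasoning

  ~-reduce : ∀ {s s'} → s ~ s' → ∃ λ i → i < n × s' ≈ s * 2 ^ i
  ~-reduce {s} (coset-step i s'≈) = i % n , m%n<n i n , ≈-trans s'≈ (≈-*ˡ s (2^≈2^% i))

  ~-cosetMin : ∀ s → s ~ cosetMin n s
  ~-cosetMin s with cosetMin-attained s
  ... | j , _ , e = coset-step j (≈-trans (≡⇒≈ e) (≈-% (s * 2 ^ j)))

  cosetMin-mono : ∀ {s s'} → s ~ s' → cosetMin n s ≤ cosetMin n s'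
  cosetMin-mono {s} {s'} s~s' with cosetMin-attained s' | ~-reduce s~s'
  ... | j , _ , e | i , _ , s'≈ = subst (cosetMin n s ≤_) (sym C[s']≡) (cosetMin-≤ s ((i + j) % n) (m%n<n (i + j) n))
    where
    C[s']≡ : cosetMin n s' ≡ (s * 2 ^ ((i + j) % n)) % N
    C[s']≡ = trans e (mod-≡ (begin
      s' * 2 ^ j                ≈⟨ ≈-*ʳ (2 ^ j) s'≈ ⟩
      s * 2 ^ i * 2 ^ j         ≡⟨ *2^-+ s i j ⟩
      s * 2 ^ (i + j)           ≈⟨ ≈-*ˡ s (2^≈2^% (i + j)) ⟩
      s * 2 ^ ((i + j) % n)     ∎))
      where open ≈-Reasoning

  cosetMin-cong : ∀ {s s'} → s ~ s' → cosetMin n s ≡ cosetMin n s'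
  cosetMin-cong s~s' = ≤-antisym (cosetMin-mono s~s') (cosetMin-mono (~-sym s~s'))

  cosetMin-injective : ∀ {s s'} → cosetMin n s ≡ cosetMin n s' → s ~ s'
  cosetMin-injective {s} {s'} e = ~-trans (~-cosetMin s) (subst (_~ s') (sym e) (~-sym (~-cosetMin s')))

  cosetMin-idem : ∀ s → cosetMin n (cosetMin n s) ≡ cosetMin n s
  cosetMin-idem s = sym (cosetMin-cong (~-cosetMin s))

  ~-nonzero : ∀ {s s'} → s ~ s' → ¬ (N ∣ s) → ¬ (N ∣ s')
  ~-nonzero {s} (coset-step i s'≈) N∤s N∣s' =
    N∤s (∣2^*⇒∣ N-odd i s (subst (N ∣_) (*-comm s (2 ^ i)) (≈0⇒∣ (≈-trans (≈-sym s'≈) (∣⇒≈0 N∣s')))))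
    where
    N-odd : Coprime N 2
    N-odd = subst (λ z → Coprime z 2) N≡ (coprime-mersenne-2 n n>0)

  diffMod≡ : ∀ x y → diffMod n x y ≡ (x + N ∸ y) % N
  diffMod≡ x y = trans (modN≡% (x + ordN n ∸ y)) (cong (λ z → (x + z ∸ y) % N) N≡)

  diffMod-+ : ∀ x y → y < N → diffMod n x y + y ≈ x
  diffMod-+ x y y<N = begin
    diffMod n x y + y          ≡⟨ cong (_+ y) (diffMod≡ x y) ⟩
    (x + N ∸ y) % N + y        ≈⟨ ≈-+ʳ y (≈-% (x + N ∸ y)) ⟩
    (x + N ∸ y) + y            ≡⟨ m∸n+n≡m (≤-trans (<⇒≤ y<N) (m≤n+m N x)) ⟩
    x + N                      ≈⟨ ≈-trans (≡⇒≈ (cong (x +_) (sym (*-identityˡ N)))) (≈-+*N x 1) ⟩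
    x                          ∎
    where open ≈-Reasoning

  diffMod-nonzero : ∀ x y → x < N → y < N → ¬ (x ≡ y) → ¬ (N ∣ diffMod n x y)
  diffMod-nonzero x y x<N y<N x≢y N∣d = x≢y (≈⇒≡ x<N y<N (begin
    x                        ≈⟨ ≈-sym (diffMod-+ x y y<N) ⟩
    diffMod n x y + y        ≈⟨ ≈-+ʳ y (∣⇒≈0 N∣d) ⟩
    0 + y                    ≡⟨⟩
    y                        ∎))
    where open ≈-Reasoning

  shift-diffMod : ∀ t i x y → x < N → t + 2 ^ i * y ≈ (t + 2 ^ i * x) + 2 ^ i * diffMod n y x
  shift-diffMod t i x y x<N = begin
    t + 2 ^ i * y                         ≈⟨ ≈-+ˡ t (≈-*ˡ (2 ^ i) (≈-sym (diffMod-+ y x x<N))) ⟩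
    t + 2 ^ i * (diffMod n y x + x)       ≡⟨ regroup t (2 ^ i) (diffMod n y x) x ⟩
    (t + 2 ^ i * x) + 2 ^ i * diffMod n y x ∎
    where
    open ≈-Reasoning
    regroup : ∀ t c d x → t + c * (d + x) ≡ (t + c * x) + c * d
    regroup = solve-∀

  ~-scaled : ∀ {a b} i j → 2 ^ i * a ≈ 2 ^ j * b → a ~ b
  ~-scaled {a} {b} i j e =
    ~-trans (coset-step i (≈-trans (≈-sym e) (≡⇒≈ (*-comm (2 ^ i) a))))
            (~-sym (coset-step j (≡⇒≈ (*-comm (2 ^ j) b))))

module Differences where
  open import Data.Bool using (Bool; true; false; if_then_else_)
  open import Data.Bool.ListAction using (any)
  open import Data.Nat using (ℕ)
  open import Data.Fin using (Fin)
  import Data.Fin as F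
  open import Data.List using (List; []; _∷_; [_]; concatMap; allFin; length)
  open import Data.List.Membership.Propositional using (_∈_)
  open import Data.List.Membership.Propositional.Properties using (∈-allFin; ∈-concatMap⁺; ∈-concatMap⁻)
  open import Data.List.Relation.Unary.Any using (Any; here; there)
  import Data.List.Relation.Unary.Any as Any
  open import Data.Product using (_,_; _×_; proj₁; proj₂; ∃)
  open import Data.Sum using (_⊎_; inj₁; inj₂)
  open import Data.Empty using (⊥-elim)
  open import Relation.Nullary using (¬_; yes; no; does)
  open import Relation.Binary.PropositionalEquality using (_≡_; refl)

  any-true : ∀ {A : Set} (p : A → Bool) xs → any p xs ≡ true → ∃ λ x → x ∈ xs × p x ≡ true
  any-true p (x ∷ xs) e with p x in px
  ... | true  = x , here refl , px
  ... | false with any-true p xs e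
  ...   | y , y∈ , py = y , there y∈ , py

  any-intro : ∀ {A : Set} (p : A → Bool) {x} xs → x ∈ xs → p x ≡ true → any p xs ≡ true
  any-intro p (x ∷ xs) (here refl) px rewrite px = refl
  any-intro p (y ∷ xs) (there x∈) px with p y
  ... | true  = refl
  ... | false = any-intro p xs x∈ px

  module _ {n} (f α : V n) where

    ofExps⁻ : ∀ e v → ofExps f α e v ≡ true → (v ≡ 0v) ⊎ (∃ λ r → v ≡ pow f α (e r))
    ofExps⁻ e v v∈ with v ≟v 0v
    ... | yes v≡0 = inj₁ v≡0
    ... | no  _   with any-true (λ r → does (v ≟v pow f α (e r))) (allFin 7) v∈
    ...   | r , _ , hit with v ≟v pow f α (e r)
    ...     | yes v≡ = inj₂ (r , v≡)
    ...     | no  _  with hit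
    ...       | ()

    ofExps-0 : ∀ e → ofExps f α e 0v ≡ true
    ofExps-0 e with (0v {n}) ≟v 0v
    ... | yes _  = refl
    ... | no 0≢0 = ⊥-elim (0≢0 refl)

    ofExps-pow : ∀ e r → ofExps f α e (pow f α (e r)) ≡ true
    ofExps-pow e r with pow f α (e r) ≟v 0v
    ... | yes _ = refl
    ... | no  _ = any-intro (λ s → does (pow f α (e r) ≟v pow f α (e s))) (allFin 7) (∈-allFin r) self
      where
      self : does (pow f α (e r) ≟v pow f α (e r)) ≡ true
      self with pow f α (e r) ≟v pow f α (e r)
      ... | yes _ = refl
      ... | no ≢  = ⊥-elim (≢ refl)

  offDiagonalEntry : ∀ {m} → Fin m → Fin m → List (Fin m × Fin m)
  offDiagonalEntry r s = if does (r F.≟ s) then [] else [ (r , s) ]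

  offDiagonalRow : ∀ m → Fin m → List (Fin m × Fin m)
  offDiagonalRow m r = concatMap (offDiagonalEntry r) (allFin m)

  offDiagonal : ∀ m → List (Fin m × Fin m)
  offDiagonal m = concatMap (offDiagonalRow m) (allFin m)

  ∈-offDiagonal⁺ : ∀ {m} {r s : Fin m} → ¬ (r ≡ s) → (r , s) ∈ offDiagonal m
  ∈-offDiagonal⁺ {m} {r} {s} r≢s =
    ∈-concatMap⁺ (offDiagonalRow m) (Any.map (λ { refl →
      ∈-concatMap⁺ (offDiagonalEntry r) (Any.map (λ { refl → kept }) (∈-allFin s)) }) (∈-allFin r))
    where
    kept : (r , s) ∈ offDiagonalEntry r s
    kept with r F.≟ s
    ... | yes r≡s = ⊥-elim (r≢s r≡s)
    ... | no  _   = here refl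

  ∈-offDiagonal⁻ : ∀ {m} {p : Fin m × Fin m} → p ∈ offDiagonal m → ¬ (proj₁ p ≡ proj₂ p)
  ∈-offDiagonal⁻ {m} {p} p∈ =
    let r , p∈row   = Any.satisfied (∈-concatMap⁻ (offDiagonalRow m) {xs = allFin m} p∈)
        s , p∈entry = Any.satisfied (∈-concatMap⁻ (offDiagonalEntry r) {xs = allFin m} p∈row)
    in  entry-off-diagonal r s p∈entry
    where
    entry-off-diagonal : ∀ r s → p ∈ offDiagonalEntry r s → ¬ (proj₁ p ≡ proj₂ p)
    entry-off-diagonal r s p∈ with r F.≟ s | p∈
    ... | no r≢s | here refl = r≢s

  diffCoset : ℕ → (Fin 7 → ℕ) → Fin 7 × Fin 7 → ℕ
  diffCoset n e (r , s) = cosetMin n (diffMod n (e r) (e s))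

  -- By computation, CΔ n e is map (diffCoset n e) (offDiagonal 7); in particular it has 42 entries.
  length-CΔ : ∀ n e → length (CΔ n e) ≡ 42
  length-CΔ n e = refl

module CompleteSubspace (n N' : ℕ) (N≡ : ordN n ≡ suc N') (n>0 : 0 < n)
                     (e : Fin 7 → ℕ) (e<N : ∀ r → e r < suc N') (complete : CosetComplete n e) where
  open Counting
  open Differences
  open CyclotomicCosets n N' N≡ n>0
  open import Data.Nat.Divisibility using (_∣_)
  open import Data.List using (map; _∷_)
  open import Data.List.Membership.Propositional using (_∈_)
  open import Data.List.Membership.Propositional.Properties using (∈-map⁺; ∈-map⁻)
  open import Data.List.Relation.Unary.Any using (here; there)
  open import Data.List.Relation.Unary.Unique.Propositional using (Unique)
  open import Data.List.Relation.Unary.AllPairs using (_∷_)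
  open import Data.Product using (_,_; _×_; proj₁; ∃)
  open import Data.Empty using (⊥-elim)
  open import Relation.Nullary using (¬_)
  open import Relation.Binary.PropositionalEquality using (refl; sym; trans; cong; cong₂; subst)

  CΔ-unique : Unique (CΔ n e)
  CΔ-unique = deduplicate-length⇒Unique (CΔ n e) (trans complete (sym (length-CΔ n e)))

  map-unique⇒injective : ∀ {A B : Set} (g : A → B) {xs x y} → Unique (map g xs) → x ∈ xs → y ∈ xs → g x ≡ g y → x ≡ y
  map-unique⇒injective g {_ ∷ _}  (_ ∷ _)    (here refl) (here refl) _ = refl
  map-unique⇒injective g {_ ∷ xs} (gx∉ ∷ _)  (here refl) (there y∈)  e = ⊥-elim (∉-from-All gx∉ (subst (_∈ map g xs) (sym e) (∈-map⁺ g y∈)))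
  map-unique⇒injective g {_ ∷ xs} (gy∉ ∷ _)  (there x∈)  (here refl) e = ⊥-elim (∉-from-All gy∉ (subst (_∈ map g xs) e (∈-map⁺ g x∈)))
  map-unique⇒injective g {_ ∷ _}  (_ ∷ u)    (there x∈)  (there y∈)  e = map-unique⇒injective g u x∈ y∈ e

  diffCoset-injective : ∀ {p q} → p ∈ offDiagonal 7 → q ∈ offDiagonal 7 → diffCoset n e p ≡ diffCoset n e q → p ≡ q
  diffCoset-injective = map-unique⇒injective (diffCoset n e) CΔ-unique

  -- In particular the seven exponents are distinct: e r = e s would make C(e r - e s) = C(e s - e r).
  e-injective : ∀ {r s} → ¬ (r ≡ s) → ¬ (e r ≡ e s)
  e-injective {r} {s} r≢s er≡es = r≢s (cong proj₁ (diffCoset-injective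
    (∈-offDiagonal⁺ r≢s) (∈-offDiagonal⁺ (λ s≡r → r≢s (sym s≡r)))
    (cong₂ (λ a b → cosetMin n (diffMod n a b)) er≡es (sym er≡es))))

  difference-nonzero : ∀ {r s} → ¬ (r ≡ s) → ¬ (N ∣ diffMod n (e r) (e s))
  difference-nonzero r≢s = diffMod-nonzero _ _ (e<N _) (e<N _) (e-injective r≢s)

  CΔ-∈⁺ : ∀ {r s} → ¬ (r ≡ s) → cosetMin n (diffMod n (e r) (e s)) ∈ CΔ n e
  CΔ-∈⁺ r≢s = ∈-map⁺ (diffCoset n e) (∈-offDiagonal⁺ r≢s)

  CΔ-∈⁻ : ∀ {c} → c ∈ CΔ n e → ∃ λ r → ∃ λ s → ¬ (r ≡ s) × c ≡ cosetMin n (diffMod n (e r) (e s))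
  CΔ-∈⁻ c∈ with ∈-map⁻ (diffCoset n e) c∈
  ... | (r , s) , p∈ , c≡ = r , s , ∈-offDiagonal⁻ p∈ , c≡

-- For n prime every nonzero cyclotomic coset modulo N = 2ⁿ - 1 has exactly n elements, so there
-- are at most (N - 1)/n of them.  When a family of coset-complete subspaces supplies
-- (N - 1)/n pairwise distinct cosets, every nonzero coset is among them.
module CosetCounting (n N' : ℕ) (N≡ : ordN n ≡ suc N') (n-prime : Prime n) where
  open Counting
  open NumberTheory
  open import Data.Nat using (zero; _+_; _*_; _∸_; _^_; _≤_; z≤n; s≤s; _%_; _≟_)
  open import Data.Nat.Properties
  open import Data.Nat.DivMod using (m%n<n)
  open import Data.Nat.Divisibility using (_∣_; _∣0)
  open import Data.Fin using (Fin)
  open import Data.List using (List; []; _∷_; _++_; applyUpTo; allFin; length)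
  open import Data.List.Properties using (length-++; length-applyUpTo; length-tabulate)
  open import Data.List.Membership.Propositional using (_∈_)
  open import Data.List.Membership.Propositional.Properties using (∈-applyUpTo⁺; ∈-applyUpTo⁻; ∈-++⁻)
  import Data.List.Membership.DecPropositional as DecMembership
  open import Data.List.Relation.Unary.Any using (here; there)
  open import Data.List.Relation.Unary.All using (All; []; _∷_)
  import Data.List.Relation.Unary.All as All
  open import Data.List.Relation.Unary.Unique.Propositional using (Unique)
  open import Data.List.Relation.Unary.Unique.Propositional.Properties using (++⁺; applyUpTo⁺₁; allFin⁺)
  open import Data.List.Relation.Unary.AllPairs using ([]; _∷_)
  open import Data.Product using (_,_; _×_; proj₂; ∃)
  open import Data.Sum using (inj₁; inj₂)
  open import Data.Empty using (⊥; ⊥-elim)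
  open import Relation.Nullary using (¬_; yes; no)
  open import Relation.Binary.PropositionalEquality using (refl; sym; trans; cong; cong₂; subst; subst₂; module ≡-Reasoning)
  open import Data.Nat.Tactic.RingSolver using (solve-∀)

  n>0 : 0 < n
  n>0 = <-trans (s≤s z≤n) (prime⇒1<n n-prime)

  open CyclotomicCosets n N' N≡ n>0 public
  open Doubling n N' N≡ n-prime using (doubling-injective)

  Representative : ℕ → Set
  Representative c = (cosetMin n c ≡ c) × ¬ (N ∣ c)

  representative-cosetMin : ∀ δ → ¬ (N ∣ δ) → Representative (cosetMin n δ)
  representative-cosetMin δ N∤δ = cosetMin-idem δ , ~-nonzero (~-cosetMin δ) N∤δ

  orbit : ℕ → List ℕ
  orbit u = applyUpTo (λ i → (u * 2 ^ i) % N) n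

  orbit-unique : ∀ u → ¬ (N ∣ u) → Unique (orbit u)
  orbit-unique u N∤u = applyUpTo⁺₁ _ n λ {i} {j} i<j j<n e →
    <-irrefl (doubling-injective u N∤u i j (<-trans i<j j<n) j<n
               (mod-eq (trans (cong (_% N) (*-comm (2 ^ i) u)) (trans e (cong (_% N) (*-comm u (2 ^ j))))))) i<j

  ∈-orbit⇒~ : ∀ {u w} → w ∈ orbit u → u ~ w
  ∈-orbit⇒~ {u} w∈ with ∈-applyUpTo⁻ _ w∈
  ... | i , _ , refl = coset-step i (≈-% (u * 2 ^ i))

  orbits-disjoint : ∀ {u u'} → Representative u → Representative u' → ∀ {w} → w ∈ orbit u → w ∈ orbit u' → u ≡ u'
  orbits-disjoint (Cu≡u , _) (Cu'≡u' , _) w∈ w∈' =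
    trans (sym Cu≡u) (trans (cosetMin-cong (~-trans (∈-orbit⇒~ w∈) (~-sym (∈-orbit⇒~ w∈')))) Cu'≡u')

  orbit-nonzero : ∀ u → ¬ (N ∣ u) → ∀ {w} → w ∈ orbit u → w ∈ applyUpTo suc N'
  orbit-nonzero u N∤u w∈ with ∈-applyUpTo⁻ _ w∈
  ... | i , _ , refl with (u * 2 ^ i) % N in e | m%n<n (u * 2 ^ i) N
  ...   | zero  | _       = ⊥-elim (~-nonzero (coset-step i (≈-sym (mod-eq {u * 2 ^ i} {0} e))) N∤u (N ∣0))
  ...   | suc w | s≤s w<N = ∈-applyUpTo⁺ suc w<N

  orbits : List ℕ → List ℕ
  orbits []       = []
  orbits (u ∷ us) = orbit u ++ orbits us

  ∈-orbits⁻ : ∀ us {w} → w ∈ orbits us → ∃ λ u → u ∈ us × w ∈ orbit u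
  ∈-orbits⁻ (u ∷ us) w∈ with ∈-++⁻ (orbit u) w∈
  ... | inj₁ w∈u  = u , here refl , w∈u
  ... | inj₂ w∈us = let u' , u'∈ , w∈u' = ∈-orbits⁻ us w∈us in u' , there u'∈ , w∈u'

  length-orbits : ∀ us → length (orbits us) ≡ length us * n
  length-orbits []       = refl
  length-orbits (u ∷ us) = trans (length-++ (orbit u)) (cong₂ _+_ (length-applyUpTo _ n) (length-orbits us))

  orbits-unique : ∀ us → Unique us → All Representative us → Unique (orbits us)
  orbits-unique []       _              _          = []
  orbits-unique (u ∷ us) (u∉us ∷ u-us) (ru ∷ rus) = ++⁺ (orbit-unique u (proj₂ ru)) (orbits-unique us u-us rus) disjoint
    where
    disjoint : ∀ {w} → w ∈ orbit u × w ∈ orbits us → ⊥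
    disjoint (w∈u , w∈us) with ∈-orbits⁻ us w∈us
    ... | u' , u'∈ , w∈u' = ∉-from-All u∉us (subst (_∈ us) (sym (orbits-disjoint ru (All.lookup rus u'∈) w∈u w∈u')) u'∈)

  representatives-bound : ∀ us → Unique us → All Representative us → length us * n ≤ N'
  representatives-bound us u-us rus =
    subst₂ _≤_ (length-orbits us) (length-applyUpTo suc N')
      (pigeonhole (orbits-unique us u-us rus) λ w∈ →
        let u , u∈ , w∈u = ∈-orbits⁻ us w∈ in orbit-nonzero u (proj₂ (All.lookup rus u∈)) w∈u)

  module Covering (M : ℕ) (M≡ : M * (42 * n) ≡ 2 ^ n ∸ 2) (E : Fin M → Fin 7 → ℕ)
                  (complete : ∀ k → CosetComplete n (E k)) (E<N : ∀ k r → E k r < N)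
                  (disjoint : ∀ k l → ¬ (k ≡ l) → DisjointCΔ n (E k) (E l)) where

    module Member k = CompleteSubspace n N' N≡ n>0 (E k) (E<N k) (complete k)

    cosetsOf : List (Fin M) → List ℕ
    cosetsOf []       = []
    cosetsOf (k ∷ ks) = CΔ n (E k) ++ cosetsOf ks

    ∈-cosetsOf⁻ : ∀ ks {c} → c ∈ cosetsOf ks → ∃ λ k → k ∈ ks × c ∈ CΔ n (E k)
    ∈-cosetsOf⁻ (k ∷ ks) c∈ with ∈-++⁻ (CΔ n (E k)) c∈
    ... | inj₁ c∈k  = k , here refl , c∈k
    ... | inj₂ c∈ks = let k' , k'∈ , c∈k' = ∈-cosetsOf⁻ ks c∈ks in k' , there k'∈ , c∈k'

    length-cosetsOf : ∀ ks → length (cosetsOf ks) ≡ 42 * length ks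
    length-cosetsOf []       = refl
    length-cosetsOf (k ∷ ks) = trans (length-++ (CΔ n (E k)) {cosetsOf ks}) (trans (cong (42 +_) (length-cosetsOf ks)) (sym (*-suc 42 (length ks))))

    cosetsOf-unique : ∀ ks → Unique ks → Unique (cosetsOf ks)
    cosetsOf-unique []       _              = []
    cosetsOf-unique (k ∷ ks) (k∉ks ∷ u-ks) = ++⁺ (Member.CΔ-unique k) (cosetsOf-unique ks u-ks) separate
      where
      separate : ∀ {c} → c ∈ CΔ n (E k) × c ∈ cosetsOf ks → ⊥
      separate (c∈k , c∈ks) with ∈-cosetsOf⁻ ks c∈ks
      ... | k' , k'∈ , c∈k' = disjoint k k' (λ k≡k' → ∉-from-All k∉ks (subst (_∈ ks) (sym k≡k') k'∈)) _ c∈k c∈k'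

    cosetsOf-representatives : ∀ ks → All Representative (cosetsOf ks)
    cosetsOf-representatives ks = All.tabulate λ c∈ →
      let k , _ , c∈k = ∈-cosetsOf⁻ ks c∈
          r , s , r≢s , c≡ = Member.CΔ-∈⁻ k c∈k
      in subst Representative (sym c≡) (representative-cosetMin _ (Member.difference-nonzero k r≢s))

    N'≡ : N' ≡ M * (42 * n)
    N'≡ = trans (cong (_∸ 1) (sym N≡)) (trans (∸-+-assoc (2 ^ n) 1 1) (sym M≡))

    -- Were C(δ) missing, the 42M listed cosets and C(δ) would give (42M + 1)·n > N - 1 coset elements.
    covered : ∀ δ → ¬ (N ∣ δ) → ∃ λ k → cosetMin n δ ∈ CΔ n (E k)
    covered δ N∤δ with DecMembership._∈?_ _≟_ (cosetMin n δ) (cosetsOf (allFin M))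
    ... | yes C∈ = let k , _ , C∈k = ∈-cosetsOf⁻ (allFin M) C∈ in k , C∈k
    ... | no  C∉ = ⊥-elim (<-irrefl refl (≤-trans too-many (representatives-bound us us-unique us-reps)))
      where
      us : List ℕ
      us = cosetMin n δ ∷ cosetsOf (allFin M)
      us-unique : Unique us
      us-unique = All.tabulate (λ c∈ e → C∉ (subst (_∈ cosetsOf (allFin M)) (sym e) c∈)) ∷ cosetsOf-unique (allFin M) (allFin⁺ M)
      us-reps : All Representative us
      us-reps = representative-cosetMin δ N∤δ ∷ cosetsOf-representatives (allFin M)
      length-us : length us * n ≡ n + M * (42 * n)
      length-us = begin
        n + length (cosetsOf (allFin M)) * n   ≡⟨ cong (λ l → n + l * n) (length-cosetsOf (allFin M)) ⟩
        n + 42 * length (allFin M) * n         ≡⟨ cong (λ l → n + 42 * l * n) (length-tabulate {n = M} (λ k → k)) ⟩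
        n + 42 * M * n                         ≡⟨ cong (n +_) (regroup M n) ⟩
        n + M * (42 * n)                       ∎
        where
        open ≡-Reasoning
        regroup : ∀ M n → 42 * M * n ≡ M * (42 * n)
        regroup = solve-∀
      too-many : suc N' ≤ length us * n
      too-many = subst₂ _≤_ (cong suc (sym N'≡)) (sym length-us) (+-monoˡ-≤ (M * (42 * n)) n>0)

module FiniteField {n} (f α : V n) (field-f : IsFieldMod f) (α-primitive : IsPrimitive f α)
                   (N' : ℕ) (N≡ : 2 ^ n ∸ 1 ≡ suc N') (α≢0 : ¬ (α ≡ 0v)) where
  open Counting
  open VectorSpace
  open QuotientRing
  open NumberTheory
  open import Data.Nat using (zero; _+_; _*_; _≤_; _<_; s≤s; _%_; _/_)
  open import Data.Nat.Properties
  open import Data.Nat.DivMod using (m≡m%n+[m/n]*n; m%n<n)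
  open import Data.Vec using (_∷_)
  open import Data.List using (List; _∷_; map; upTo)
  open import Data.List.Properties using (length-map; length-upTo)
  open import Data.List.Membership.Propositional using (_∈_)
  open import Data.List.Membership.Propositional.Properties using (∈-map⁺; ∈-upTo⁺)
  open import Data.List.Relation.Unary.Any using (here; there)
  open import Data.Product using (_,_; ∃; _×_)
  open import Data.Empty using (⊥-elim)
  open import Relation.Nullary using (yes; no)
  open import Relation.Binary.Definitions using (tri<; tri≈; tri>)
  open import Relation.Binary.PropositionalEquality using (refl; sym; trans; cong; cong₂; subst; subst₂)
  open Relation.Binary.PropositionalEquality.≡-Reasoning

  open RingLaws f public
  open Congruence N'

  ·-nonzero : ∀ a b → ¬ (a ≡ 0v) → ¬ (b ≡ 0v) → ¬ (a · b ≡ 0v)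
  ·-nonzero a b a≢0 b≢0 ab≡0 with field-f a a≢0
  ... | a⁻¹ , aa⁻¹≡1 = b≢0 (begin
    b               ≡⟨ sym (·-identityˡ b) ⟩
    1v · b          ≡⟨ cong (_· b) (sym (trans (·-comm a⁻¹ a) aa⁻¹≡1)) ⟩
    (a⁻¹ · a) · b   ≡⟨ ·-assoc a⁻¹ a b ⟩
    a⁻¹ · (a · b)   ≡⟨ cong (a⁻¹ ·_) ab≡0 ⟩
    a⁻¹ · 0v        ≡⟨ ·-zeroʳ a⁻¹ ⟩
    0v              ∎)

  ·-cancelˡ : ∀ a b c → ¬ (a ≡ 0v) → a · b ≡ a · c → b ≡ c
  ·-cancelˡ a b c a≢0 ab≡ac with field-f a a≢0
  ... | a⁻¹ , aa⁻¹≡1 = begin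
    b               ≡⟨ sym (·-identityˡ b) ⟩
    1v · b          ≡⟨ cong (_· b) (sym a⁻¹a≡1) ⟩
    (a⁻¹ · a) · b   ≡⟨ ·-assoc a⁻¹ a b ⟩
    a⁻¹ · (a · b)   ≡⟨ cong (a⁻¹ ·_) ab≡ac ⟩
    a⁻¹ · (a · c)   ≡⟨ sym (·-assoc a⁻¹ a c) ⟩
    (a⁻¹ · a) · c   ≡⟨ cong (_· c) a⁻¹a≡1 ⟩
    1v · c          ≡⟨ ·-identityˡ c ⟩
    c               ∎
    where a⁻¹a≡1 = trans (·-comm a⁻¹ a) aa⁻¹≡1

  P : ℕ → V n
  P = pow f α

  pow-+ : ∀ a b → P (a + b) ≡ P a · P b
  pow-+ zero    b = sym (·-identityˡ (P b))
  pow-+ (suc a) b = trans (cong (α ·_) (pow-+ a b)) (sym (·-assoc α (P a) (P b)))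

  pow-* : ∀ p → P p ≡ 1v → ∀ q → P (q * p) ≡ 1v
  pow-* p αᵖ≡1 zero    = refl
  pow-* p αᵖ≡1 (suc q) = trans (pow-+ p (q * p)) (trans (cong₂ _·_ αᵖ≡1 (pow-* p αᵖ≡1 q)) (·-identityˡ 1v))

  pow-periodic : ∀ p → P (suc p) ≡ 1v → ∀ x → P x ≡ P (x % suc p)
  pow-periodic p period x = begin
    P x                                     ≡⟨ cong P (m≡m%n+[m/n]*n x (suc p)) ⟩
    P (x % suc p + (x / suc p) * suc p)     ≡⟨ pow-+ (x % suc p) ((x / suc p) * suc p) ⟩
    P (x % suc p) · P ((x / suc p) * suc p) ≡⟨ cong (P (x % suc p) ·_) (pow-* (suc p) period (x / suc p)) ⟩
    P (x % suc p) · 1v                      ≡⟨ ·-identityʳ (P (x % suc p)) ⟩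
    P (x % suc p)                           ∎

  1v≢0 : ¬ (1v ≡ 0v)
  1v≢0 = one≢0 (nonzero⇒1≤n α α≢0)

  P≢0 : ∀ x → ¬ (P x ≡ 0v)
  P≢0 zero    = 1v≢0
  P≢0 (suc x) = ·-nonzero α (P x) α≢0 (P≢0 x)

  -- If α^(p+1) = 1 then {0} ∪ {α⁰, …, α^p} lists all 2ⁿ field elements, so p + 1 ≥ N.
  period-≥ : ∀ p → P (suc p) ≡ 1v → N ≤ suc p
  period-≥ p period = subst (_≤ suc p) N≡ (∸-monoˡ-≤ 1 2ⁿ≤p+2)
    where
    listed : List (V n)
    listed = 0v ∷ map P (upTo (suc p))
    all-listed : ∀ {v} → v ∈ allVecs n → v ∈ listed
    all-listed {v} _ with v ≟v 0v
    ... | yes v≡0 = here v≡0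
    ... | no  v≢0 with α-primitive v v≢0
    ...   | i , _ , αⁱ≡v = there (subst (_∈ map P (upTo (suc p))) (trans (sym (pow-periodic p period i)) αⁱ≡v)
                                      (∈-map⁺ P (∈-upTo⁺ (m%n<n i (suc p)))))
    2ⁿ≤p+2 : 2 ^ n ≤ suc (suc p)
    2ⁿ≤p+2 = subst₂ _≤_ (length-allVecs n) (cong suc (trans (length-map P (upTo (suc p))) (length-upTo (suc p))))
               (pigeonhole (allVecs-unique n) all-listed)

  private
    split-< : ∀ {j m} → j < m → ∃ λ d → j + suc d ≡ m
    split-< {j} {suc m} (s≤s j≤m) = m ∸ j , trans (+-suc j (m ∸ j)) (cong suc (m+[n∸m]≡n j≤m))

    period-from-repeat : ∀ a d → P (a + suc d) ≡ P a → P (suc d) ≡ 1v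
    period-from-repeat a d e = ·-cancelˡ (P a) (P (suc d)) 1v (P≢0 a)
      (trans (sym (pow-+ a (suc d))) (trans e (sym (·-identityʳ (P a)))))

  -- α has order N: α^N is some α^j with j < N, and j > 0 would give a period N - j < N.
  pow-N : P N ≡ 1v
  pow-N with α-primitive (P N) (P≢0 N)
  ... | zero  , _   , e = sym e
  ... | suc j , j<N , e with split-< (subst (suc j <_) N≡ j<N)
  ...   | d , j+d+1≡N = ⊥-elim (<⇒≱ d+1<N (period-≥ d (period-from-repeat (suc j) d (trans (cong P j+d+1≡N) (sym e)))))
    where
    d+1<N : suc d < N
    d+1<N = subst (suc d <_) j+d+1≡N (s≤s (m≤n+m (suc d) j))

  pow-cong : ∀ {x y} → x ≈ y → P x ≡ P y
  pow-cong {x} {y} (mod-eq e) = begin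
    P x        ≡⟨ pow-periodic N' pow-N x ⟩
    P (x % N)  ≡⟨ cong P e ⟩
    P (y % N)  ≡⟨ sym (pow-periodic N' pow-N y) ⟩
    P y        ∎

  private
    pow-injective-< : ∀ a b → a < b → b < N → ¬ (P a ≡ P b)
    pow-injective-< a b a<b b<N e with split-< a<b
    ... | d , a+d+1≡b = <⇒≱ d+1<N (period-≥ d (period-from-repeat a d (trans (cong P a+d+1≡b) (sym e))))
      where
      d+1<N : suc d < N
      d+1<N = ≤-<-trans (subst (suc d ≤_) a+d+1≡b (m≤n+m (suc d) a)) b<N

  pow-injective : ∀ {x y} → P x ≡ P y → x ≈ y
  pow-injective {x} {y} e with <-cmp (x % N) (y % N)
  ... | tri< lt _ _ = ⊥-elim (pow-injective-< _ _ lt (m%n<n y N) (trans (pow-cong (≈-% x)) (trans e (sym (pow-cong (≈-% y))))))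
  ... | tri≈ _ eq _ = mod-eq eq
  ... | tri> _ _ gt = ⊥-elim (pow-injective-< _ _ gt (m%n<n x N) (trans (pow-cong (≈-% y)) (trans (sym e) (sym (pow-cong (≈-% x))))))

  record Log (w : V n) : Set where
    field
      exponent   : ℕ
      exponent<N : exponent < N
      pow≡       : P exponent ≡ w

  log : ∀ w → ¬ (w ≡ 0v) → Log w
  log w w≢0 with α-primitive w w≢0
  ... | a , a<2ⁿ-1 , αᵃ≡w = record { exponent = a ; exponent<N = subst (a <_) N≡ a<2ⁿ-1 ; pow≡ = αᵃ≡w }

  square-⊕ : ∀ u v → (u ⊕ v) · (u ⊕ v) ≡ (u · u) ⊕ (v · v)
  square-⊕ u v = begin
    (u ⊕ v) · (u ⊕ v)                          ≡⟨ ·-distribʳ-⊕ u v (u ⊕ v) ⟩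
    (u · (u ⊕ v)) ⊕ (v · (u ⊕ v))              ≡⟨ cong₂ _⊕_ (·-distribˡ-⊕ u u v) (·-distribˡ-⊕ v u v) ⟩
    ((u · u) ⊕ (u · v)) ⊕ ((v · u) ⊕ (v · v))  ≡⟨ cong (λ z → ((u · u) ⊕ (u · v)) ⊕ (z ⊕ (v · v))) (·-comm v u) ⟩
    ((u · u) ⊕ (u · v)) ⊕ ((u · v) ⊕ (v · v))  ≡⟨ ⊕-assoc (u · u) (u · v) _ ⟩
    (u · u) ⊕ ((u · v) ⊕ ((u · v) ⊕ (v · v)))  ≡⟨ cong ((u · u) ⊕_) (sym (⊕-assoc (u · v) (u · v) (v · v))) ⟩
    (u · u) ⊕ (((u · v) ⊕ (u · v)) ⊕ (v · v))  ≡⟨ cong (λ z → (u · u) ⊕ (z ⊕ (v · v))) (⊕-self (u · v)) ⟩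
    (u · u) ⊕ (0v ⊕ (v · v))                   ≡⟨ cong ((u · u) ⊕_) (⊕-identityˡ (v · v)) ⟩
    (u · u) ⊕ (v · v)                          ∎

  frobenius : ℕ → V n → V n
  frobenius zero    u = u
  frobenius (suc i) u = frobenius i u · frobenius i u

  frobenius-⊕ : ∀ i u v → frobenius i (u ⊕ v) ≡ frobenius i u ⊕ frobenius i v
  frobenius-⊕ zero    u v = refl
  frobenius-⊕ (suc i) u v = trans (cong (λ w → w · w) (frobenius-⊕ i u v)) (square-⊕ (frobenius i u) (frobenius i v))

  frobenius-0 : ∀ i → frobenius i 0v ≡ 0v
  frobenius-0 zero    = refl
  frobenius-0 (suc i) = trans (cong (λ w → w · w) (frobenius-0 i)) (·-zeroˡ 0v)

  frobenius-pow : ∀ i e → frobenius i (P e) ≡ P (2 ^ i * e)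
  frobenius-pow zero    e = cong P (sym (+-identityʳ e))
  frobenius-pow (suc i) e = begin
    frobenius i (P e) · frobenius i (P e)  ≡⟨ cong (λ w → w · w) (frobenius-pow i e) ⟩
    P (2 ^ i * e) · P (2 ^ i * e)          ≡⟨ sym (pow-+ (2 ^ i * e) (2 ^ i * e)) ⟩
    P (2 ^ i * e + 2 ^ i * e)              ≡⟨ cong P (double (2 ^ i)) ⟩
    P (2 ^ suc i * e)                      ∎
    where
    double : ∀ a → a * e + a * e ≡ (2 * a) * e
    double a = trans (sym (*-distribʳ-+ e a a)) (cong (λ z → (a + z) * e) (sym (+-identityʳ a)))

  twist : ℕ → ℕ → V n → V n
  twist i t u = P t · frobenius i u

  twist-⊕ : ∀ i t u v → twist i t (u ⊕ v) ≡ twist i t u ⊕ twist i t v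
  twist-⊕ i t u v = trans (cong (P t ·_) (frobenius-⊕ i u v)) (·-distribˡ-⊕ (P t) (frobenius i u) (frobenius i v))

  twist-0 : ∀ i t → twist i t 0v ≡ 0v
  twist-0 i t = trans (cong (P t ·_) (frobenius-0 i)) (·-zeroʳ (P t))

  twist-pow : ∀ i t e → twist i t (P e) ≡ P (t + 2 ^ i * e)
  twist-pow i t e = trans (cong (P t ·_) (frobenius-pow i e)) (sym (pow-+ t (2 ^ i * e)))

module Blocks {n} (f α : V n) (field-f : IsFieldMod f) (α-primitive : IsPrimitive f α)
              (N' : ℕ) (N≡ : 2 ^ n ∸ 1 ≡ suc N') (α≢0 : ¬ (α ≡ 0v)) where
  open Counting
  open QuotientRing using (nonzero⇒1≤n)
  open Differences
  open FiniteField f α field-f α-primitive N' N≡ α≢0 public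
  open CyclotomicCosets n N' N≡ (nonzero⇒1≤n α α≢0) public
  open import Data.Nat using (_+_; _*_; _<_)
  open import Data.Nat.Properties using (≤-antisym; +-comm)
  open import Data.Fin using (Fin)
  import Data.Fin as F
  open import Data.List using (List; _∷_; map; allFin)
  open import Data.List.Membership.Propositional using (_∈_)
  open import Data.List.Membership.Propositional.Properties using (∈-map⁺; ∈-map⁻; ∈-allFin)
  open import Data.List.Relation.Unary.Any using (here; there)
  import Data.List.Relation.Unary.All as All
  open import Data.List.Relation.Unary.Unique.Propositional using (Unique)
  open import Data.List.Relation.Unary.Unique.Propositional.Properties using (map⁺; allFin⁺)
  open import Data.List.Relation.Unary.AllPairs using (_∷_)
  open import Data.Product using (_,_; _×_; ∃)
  open import Data.Sum using (inj₁; inj₂)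
  open import Data.Empty using (⊥-elim)
  open import Relation.Nullary using (yes; no)
  open import Data.Bool using (true)
  open import Relation.Binary.PropositionalEquality using (refl; sym; trans; subst)

  blockExps : (Fin 7 → ℕ) → ℕ → ℕ → Fin 7 → ℕ
  blockExps e i t r = t + 2 ^ i * e r

  block : (Fin 7 → ℕ) → ℕ → ℕ → VSet n
  block e i t = ofExps f α (blockExps e i t)

  block-0 : ∀ e i t → block e i t 0v ≡ true
  block-0 e i t = ofExps-0 f α (blockExps e i t)

  block-pow : ∀ e i t r → block e i t (P (blockExps e i t r)) ≡ true
  block-pow e i t r = ofExps-pow f α (blockExps e i t) r

  block-nonzero⁻ : ∀ e i t w → block e i t w ≡ true → ¬ (w ≡ 0v) → ∃ λ r → w ≡ P (blockExps e i t r)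
  block-nonzero⁻ e i t w w∈ w≢0 with ofExps⁻ f α (blockExps e i t) w w∈
  ... | inj₁ w≡0 = ⊥-elim (w≢0 w≡0)
  ... | inj₂ r,w≡ = r,w≡

  block⁻ : ∀ e i t w → block e i t w ≡ true → ∃ λ y → (ofExps f α e y ≡ true) × (w ≡ twist i t y)
  block⁻ e i t w w∈ with ofExps⁻ f α (blockExps e i t) w w∈
  ... | inj₁ w≡0       = 0v , ofExps-0 f α e , trans w≡0 (sym (twist-0 i t))
  ... | inj₂ (r , w≡) = P (e r) , ofExps-pow f α e r , trans w≡ (sym (twist-pow i t (e r)))

  block⁺ : ∀ e i t y → ofExps f α e y ≡ true → block e i t (twist i t y) ≡ true
  block⁺ e i t y y∈ with ofExps⁻ f α e y y∈
  ... | inj₁ refl       = subst (λ z → block e i t z ≡ true) (sym (twist-0 i t)) (block-0 e i t)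
  ... | inj₂ (r , refl) = subst (λ z → block e i t z ≡ true) (sym (twist-pow i t (e r))) (block-pow e i t r)

  block-subspace : ∀ e i t → IsSubspace (ofExps f α e) → IsSubspace (block e i t)
  block-subspace e i t (_ , ⊕-closed) = block-0 e i t , closed
    where
    closed : ∀ w₁ w₂ → block e i t w₁ ≡ true → block e i t w₂ ≡ true → block e i t (w₁ ⊕ w₂) ≡ true
    closed w₁ w₂ w₁∈ w₂∈ with block⁻ e i t w₁ w₁∈ | block⁻ e i t w₂ w₂∈
    ... | y₁ , y₁∈ , refl | y₂ , y₂∈ , refl =
      subst (λ z → block e i t z ≡ true) (twist-⊕ i t y₁ y₂) (block⁺ e i t (y₁ ⊕ y₂) (⊕-closed y₁ y₂ y₁∈ y₂∈))

  module _ (e : Fin 7 → ℕ) (e<N : ∀ r → e r < N) (e-injective : ∀ {r s} → ¬ (r ≡ s) → ¬ (e r ≡ e s)) where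

    blockElem : ℕ → ℕ → Fin 7 → V n
    blockElem i t r = P (blockExps e i t r)

    blockElem-injective : ∀ i t {r s} → blockElem i t r ≡ blockElem i t s → r ≡ s
    blockElem-injective i t {r} {s} e≡ with r F.≟ s
    ... | yes r≡s = r≡s
    ... | no  r≢s = ⊥-elim (e-injective r≢s (≈⇒≡ (e<N r) (e<N s) (2^*-cancelˡ i (≈-cancelʳ t
            (≈-trans (≡⇒≈ (+-comm (2 ^ i * e r) t)) (≈-trans (pow-injective e≡) (≡⇒≈ (+-comm t (2 ^ i * e s)))))))))

    block-card : ∀ i t → card (block e i t) ≡ 8
    block-card i t = ≤-antisym (card-≤ (block e i t) elems all-listed) (card-≥ (block e i t) elems elems-unique listed-in)
      where
      elems : List (V n)
      elems = 0v ∷ map (blockElem i t) (allFin 7)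
      elems-unique : Unique elems
      elems-unique = All.tabulate 0∉ ∷ map⁺ (blockElem-injective i t) (allFin⁺ 7)
        where
        0∉ : ∀ {w} → w ∈ map (blockElem i t) (allFin 7) → ¬ (0v ≡ w)
        0∉ w∈ 0≡w with ∈-map⁻ (blockElem i t) w∈
        ... | r , _ , refl = P≢0 (blockExps e i t r) (sym 0≡w)
      listed-in : ∀ {w} → w ∈ elems → block e i t w ≡ true
      listed-in (here refl) = block-0 e i t
      listed-in (there w∈) with ∈-map⁻ (blockElem i t) w∈
      ... | r , _ , refl = block-pow e i t r
      all-listed : ∀ w → block e i t w ≡ true → w ∈ elems
      all-listed w w∈ with ofExps⁻ f α (blockExps e i t) w w∈
      ... | inj₁ w≡0       = here w≡0
      ... | inj₂ (r , w≡) = there (subst (_∈ map (blockElem i t) (allFin 7)) (sym w≡) (∈-map⁺ (blockElem i t) (∈-allFin r)))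

module Reindexing where
  open import Data.Fin using (Fin)
  open import Data.Product using (_,_; _×_; ∃)
  open import Function using (_∘_; _↔_; Inverse)
  open import Relation.Binary.PropositionalEquality using (_≡_; sym; trans; cong; subst)

  steiner-reindex : ∀ {t k n m} {I : Set} → Fin m ↔ I → (S : I → VSet n) →
    (∀ x → IsSubspaceOfDim k (S x)) →
    (∀ T → IsSubspaceOfDim t T → ∃ λ x → (T ⊆ S x) × (∀ y → T ⊆ S y → y ≡ x)) →
    SteinerStructure2 t k n
  steiner-reindex {m = m} Fin↔I S S-dim unique-cover = m , S ∘ to , S-dim ∘ to , λ T T-dim →
    let x , T⊆Sx , unique = unique-cover T T-dim
    in  from x , subst (λ z → T ⊆ S z) (sym (strictlyInverseˡ x)) T⊆Sx
               , λ j T⊆Sj → trans (sym (strictlyInverseʳ j)) (cong from (unique (to j) T⊆Sj))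
    where open Inverse Fin↔I

module Construction (n : ℕ) (n-prime : Prime n) (f α : V n) (field-f : IsFieldMod f) (α-primitive : IsPrimitive f α)
                    (N' : ℕ) (N≡ : 2 ^ n ∸ 1 ≡ suc N') (α≢0 : ¬ (α ≡ 0v))
                    (M : ℕ) (M≡ : M * (42 * n) ≡ 2 ^ n ∸ 2) (E : Fin M → Fin 7 → ℕ)
                    (subspaces : ∀ k → IsCCSubspace f α (E k))
                    (disjoint : ∀ k l → ¬ (k ≡ l) → DisjointCΔ n (E k) (E l)) where
  open VectorSpace
  open NumberTheory using (module Doubling)
  open Differences
  open Blocks f α field-f α-primitive N' N≡ α≢0
  open CosetCounting n N' N≡ n-prime using (module Covering)
  open import Data.Nat using (_+_; _<_)
  open import Data.Nat.Properties using (+-comm; *-comm)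
  import Data.Fin as F
  open import Data.Product using (_,_; _×_; proj₁; proj₂; ∃)
  open import Data.Empty using (⊥-elim)
  open import Data.Nat.Divisibility using (_∣_)
  open import Relation.Nullary using (yes; no)
  open import Data.Bool using (true)
  open import Relation.Binary.PropositionalEquality using (sym; trans; cong; cong₂; subst; subst₂)
  open import Data.Fin.Properties using (toℕ-fromℕ<; toℕ<n; toℕ-injective; *↔×)
  open import Function using (_↔_)
  open import Function.Construct.Identity using (↔-id)
  open import Function.Construct.Composition using (_↔-∘_)
  open import Data.Product.Function.NonDependent.Propositional using (_×-↔_)
  open Reindexing
  open import Data.List.Membership.Propositional using (_∈_)

  E<N : ∀ k r → E k r < N
  E<N k r = subst (E k r <_) N≡ (proj₁ (subspaces k) r)

  complete : ∀ k → CosetComplete n (E k)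
  complete k = proj₂ (proj₂ (subspaces k))

  open Covering M M≡ E complete E<N disjoint using (module Member; covered)
  open Doubling n N' N≡ n-prime using (doubling-injective)

  S : Fin M → ℕ → ℕ → VSet n
  S k = block (E k)

  S-dim : ∀ k i t → IsSubspaceOfDim 3 (S k i t)
  S-dim k i t = block-subspace (E k) i t (proj₁ (proj₁ (proj₂ (subspaces k))))
              , block-card (E k) (E<N k) (Member.e-injective k) i t

  record Placement (T : VSet n) : Set where
    field
      k   : Fin M
      i t : ℕ
      i<n : i < n
      t<N : t < N
      T⊆S : T ⊆ S k i t

  -- Every nonzero δ ∈ ℤ/N is 2ⁱ (E k r - E k s) for some k, some r ≠ s and some i < n: its coset
  -- is one of the C(E k r - E k s), and the coset element can be reached with an exponent below n.
  record Representation (δ : ℕ) : Set where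
    field
      k   : Fin M
      r s : Fin 7
      i   : ℕ
      i<n : i < n
      δ≈  : 2 ^ i * diffMod n (E k r) (E k s) ≈ δ

  representation : ∀ δ → ¬ (N ∣ δ) → Representation δ
  representation δ N∤δ = record { k = k ; r = r ; s = s ; i = i ; i<n = i<n ; δ≈ = δ≈ }
    where
    k : Fin M
    k = proj₁ (covered δ N∤δ)
    match : ∃ λ r → ∃ λ s → ¬ (r ≡ s) × cosetMin n δ ≡ cosetMin n (diffMod n (E k r) (E k s))
    match = Member.CΔ-∈⁻ k (proj₂ (covered δ N∤δ))
    r s : Fin 7
    r = proj₁ match
    s = proj₁ (proj₂ match)
    scaling : ∃ λ i → i < n × δ ≈ diffMod n (E k r) (E k s) * 2 ^ i
    scaling = ~-reduce (cosetMin-injective (sym (proj₂ (proj₂ (proj₂ match)))))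
    i : ℕ
    i = proj₁ scaling
    i<n : i < n
    i<n = proj₁ (proj₂ scaling)
    δ≈ : 2 ^ i * diffMod n (E k r) (E k s) ≈ δ
    δ≈ = ≈-trans (≡⇒≈ (*-comm (2 ^ i) _)) (≈-sym (proj₂ (proj₂ scaling)))

  -- Existence.  Write the plane as T = {0, α^a, α^b, …} and δ = b - a ≡ 2ⁱ (E k r - E k s);
  -- choosing t = a - 2ⁱ E k s puts α^a and α^b, hence all of T, into S k i t.
  placement : (T : VSet n) → IsSubspaceOfDim 2 T → Placement T
  placement T T-dim = record { k = k ; i = i ; t = t ; i<n = i<n ; t<N = ⊖<N a (2 ^ i * E k s) ; T⊆S = T⊆S }
    where
    p : Plane T
    p = plane T T-dim
    open Plane p
    open Log (log u u≢0) renaming (exponent to a; exponent<N to a<N; pow≡ to αᵃ≡u)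
    open Log (log v v≢0) renaming (exponent to b; exponent<N to b<N; pow≡ to αᵇ≡v)
    δ : ℕ
    δ = diffMod n b a
    N∤δ : ¬ (N ∣ δ)
    N∤δ = diffMod-nonzero b a b<N a<N (λ b≡a → u≢v (trans (sym αᵃ≡u) (trans (cong P (sym b≡a)) αᵇ≡v)))
    open Representation (representation δ N∤δ)
    t : ℕ
    t = a ⊖ (2 ^ i * E k s)
    shift-a : t + 2 ^ i * E k s ≈ a
    shift-a = ⊖-+ a (2 ^ i * E k s)
    shift-b : t + 2 ^ i * E k r ≈ b
    shift-b = begin
      t + 2 ^ i * E k r                                        ≈⟨ shift-diffMod t i (E k s) (E k r) (E<N k s) ⟩
      (t + 2 ^ i * E k s) + 2 ^ i * diffMod n (E k r) (E k s)  ≈⟨ ≈-+ shift-a δ≈ ⟩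
      a + δ                                                    ≡⟨ +-comm a δ ⟩
      δ + a                                                    ≈⟨ diffMod-+ b a a<N ⟩
      b                                                        ∎
      where open ≈-Reasoning
    u∈S : S k i t u ≡ true
    u∈S = subst (λ w → S k i t w ≡ true) (trans (pow-cong shift-a) αᵃ≡u) (block-pow (E k) i t s)
    v∈S : S k i t v ≡ true
    v∈S = subst (λ w → S k i t w ≡ true) (trans (pow-cong shift-b) αᵇ≡v) (block-pow (E k) i t r)
    T⊆S : T ⊆ S k i t
    T⊆S = plane-⊆ p (proj₁ (S-dim k i t)) u∈S v∈S

  record Anchors {T : VSet n} (p : Plane T) (k : Fin M) (i t : ℕ) : Set where
    field
      r s : Fin 7
      r≢s : ¬ (r ≡ s)
      u≡  : Plane.u p ≡ P (blockExps (E k) i t r)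
      v≡  : Plane.v p ≡ P (blockExps (E k) i t s)

  anchors : ∀ {T} (p : Plane T) {k i t} → T ⊆ S k i t → Anchors p k i t
  anchors p {k} {i} {t} T⊆S = record { r = r ; s = s ; r≢s = r≢s ; u≡ = u≡ ; v≡ = v≡ }
    where
    open Plane p
    u-anchor : ∃ λ r → u ≡ P (blockExps (E k) i t r)
    u-anchor = block-nonzero⁻ (E k) i t u (T⊆S u u∈T) u≢0
    v-anchor : ∃ λ s → v ≡ P (blockExps (E k) i t s)
    v-anchor = block-nonzero⁻ (E k) i t v (T⊆S v v∈T) v≢0
    r s : Fin 7
    r = proj₁ u-anchor
    s = proj₁ v-anchor
    u≡ : u ≡ P (blockExps (E k) i t r)
    u≡ = proj₂ u-anchor
    v≡ : v ≡ P (blockExps (E k) i t s)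
    v≡ = proj₂ v-anchor
    r≢s : ¬ (r ≡ s)
    r≢s r≡s = u≢v (trans u≡ (trans (cong (λ z → P (blockExps (E k) i t z)) r≡s) (sym v≡)))

  anchoredDiff : ∀ {T} {p : Plane T} {k i t} → Anchors p k i t → ℕ
  anchoredDiff {k = k} {i} A = 2 ^ i * diffMod n (E k (Anchors.s A)) (E k (Anchors.r A))

  same-anchoredDiff : ∀ {T} {p : Plane T} {k₁ i₁ t₁ k₂ i₂ t₂} (A₁ : Anchors p k₁ i₁ t₁) (A₂ : Anchors p k₂ i₂ t₂) →
                      anchoredDiff A₁ ≈ anchoredDiff A₂
  same-anchoredDiff {k₁ = k₁} {i₁} {t₁} {k₂} {i₂} {t₂} A₁ A₂ = ≈-cancelˡ (x₁) (begin
      x₁ + anchoredDiff A₁   ≈⟨ ≈-sym (shift-diffMod t₁ i₁ (E k₁ (Anchors.r A₁)) (E k₁ (Anchors.s A₁)) (E<N k₁ _)) ⟩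
      y₁                     ≈⟨ pow-injective (trans (sym (Anchors.v≡ A₁)) (Anchors.v≡ A₂)) ⟩
      y₂                     ≈⟨ shift-diffMod t₂ i₂ (E k₂ (Anchors.r A₂)) (E k₂ (Anchors.s A₂)) (E<N k₂ _) ⟩
      x₂ + anchoredDiff A₂   ≈⟨ ≈-+ʳ (anchoredDiff A₂) (≈-sym x₁≈x₂) ⟩
      x₁ + anchoredDiff A₂   ∎)
    where
    open ≈-Reasoning
    x₁ x₂ y₁ y₂ : ℕ
    x₁ = blockExps (E k₁) i₁ t₁ (Anchors.r A₁)
    x₂ = blockExps (E k₂) i₂ t₂ (Anchors.r A₂)
    y₁ = blockExps (E k₁) i₁ t₁ (Anchors.s A₁)
    y₂ = blockExps (E k₂) i₂ t₂ (Anchors.s A₂)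
    x₁≈x₂ : x₁ ≈ x₂
    x₁≈x₂ = pow-injective (trans (sym (Anchors.u≡ A₁)) (Anchors.u≡ A₂))

  -- Within a single X_k: the same anchoring pair forces the same i (the n elements 2ⁱ δ of a
  -- nonzero coset are distinct) and then the same t.
  unique-within : ∀ {T} {p : Plane T} {k i₁ t₁ i₂ t₂} (A₁ : Anchors p k i₁ t₁) (A₂ : Anchors p k i₂ t₂) →
                  i₁ < n → i₂ < n → t₁ < N → t₂ < N → (i₁ ≡ i₂) × (t₁ ≡ t₂)
  unique-within {k = k} {i₁} {t₁} {i₂} {t₂} A₁ A₂ i₁<n i₂<n t₁<N t₂<N = i₁≡i₂ , t₁≡t₂
    where
    module A₁ = Anchors A₁
    module A₂ = Anchors A₂
    δ : Fin 7 → Fin 7 → ℕ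
    δ r s = diffMod n (E k s) (E k r)
    same-pair : (A₁.s , A₁.r) ≡ (A₂.s , A₂.r)
    same-pair = Member.diffCoset-injective k (∈-offDiagonal⁺ (λ e → A₁.r≢s (sym e))) (∈-offDiagonal⁺ (λ e → A₂.r≢s (sym e)))
                  (cosetMin-cong (~-scaled i₁ i₂ (same-anchoredDiff A₁ A₂)))
    r≡ : A₁.r ≡ A₂.r
    r≡ = cong proj₂ same-pair
    s≡ : A₁.s ≡ A₂.s
    s≡ = cong proj₁ same-pair
    i₁≡i₂ : i₁ ≡ i₂
    i₁≡i₂ = doubling-injective (δ A₂.r A₂.s) (Member.difference-nonzero k (λ e → A₂.r≢s (sym e))) i₁ i₂ i₁<n i₂<n
              (subst (λ d → 2 ^ i₁ * d ≈ 2 ^ i₂ * δ A₂.r A₂.s) (cong₂ δ r≡ s≡) (same-anchoredDiff A₁ A₂))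
    t₁≡t₂ : t₁ ≡ t₂
    t₁≡t₂ = ≈⇒≡ t₁<N t₂<N (≈-cancelʳ (2 ^ i₁ * E k A₁.r)
              (subst (λ x → t₁ + 2 ^ i₁ * E k A₁.r ≈ t₂ + x) (cong₂ (λ i r → 2 ^ i * E k r) (sym i₁≡i₂) (sym r≡))
                (pow-injective (trans (sym A₁.u≡) A₂.u≡))))

  -- Uniqueness.  Two blocks containing T see cosets C(δ₁) = C(δ₂) of their anchoring differences;
  -- disjointness of the C(Δ(X_k)) forces the same k, and unique-within does the rest.
  placement-unique : ∀ {T} (p : Plane T) {k₁ i₁ t₁ k₂ i₂ t₂} → i₁ < n → i₂ < n → t₁ < N → t₂ < N →
                     T ⊆ S k₁ i₁ t₁ → T ⊆ S k₂ i₂ t₂ → (k₁ ≡ k₂) × (i₁ ≡ i₂) × (t₁ ≡ t₂)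
  placement-unique {T} p {k₁} {i₁} {t₁} {k₂} {i₂} {t₂} i₁<n i₂<n t₁<N t₂<N T⊆₁ T⊆₂ =
    k₁≡k₂ , unique-within A₁ (anchors p {k₁} {i₂} {t₂} (subst (λ k → T ⊆ S k i₂ t₂) (sym k₁≡k₂) T⊆₂)) i₁<n i₂<n t₁<N t₂<N
    where
    A₁ : Anchors p k₁ i₁ t₁
    A₁ = anchors p {k₁} {i₁} {t₁} T⊆₁
    A₂ : Anchors p k₂ i₂ t₂
    A₂ = anchors p {k₂} {i₂} {t₂} T⊆₂
    module A₁ = Anchors A₁
    module A₂ = Anchors A₂
    C₁≡C₂ : cosetMin n (diffMod n (E k₁ A₁.s) (E k₁ A₁.r)) ≡ cosetMin n (diffMod n (E k₂ A₂.s) (E k₂ A₂.r))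
    C₁≡C₂ = cosetMin-cong (~-scaled i₁ i₂ (same-anchoredDiff A₁ A₂))
    k₁≡k₂ : k₁ ≡ k₂
    k₁≡k₂ with k₁ F.≟ k₂
    ... | yes k₁≡k₂ = k₁≡k₂
    ... | no  k₁≢k₂ = ⊥-elim (disjoint k₁ k₂ k₁≢k₂ _ (Member.CΔ-∈⁺ k₁ (λ e → A₁.r≢s (sym e)))
                        (subst (_∈ CΔ n (E k₂)) (sym C₁≡C₂) (Member.CΔ-∈⁺ k₂ (λ e → A₂.r≢s (sym e)))))

  Index : Set
  Index = Fin M × Fin n × Fin N

  block-at : Index → VSet n
  block-at (k , i , t) = S k (F.toℕ i) (F.toℕ t)

  unique-block : ∀ T → IsSubspaceOfDim 2 T → ∃ λ x → (T ⊆ block-at x) × (∀ y → T ⊆ block-at y → y ≡ x)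
  unique-block T T-dim = (k , F.fromℕ< i<n , F.fromℕ< t<N) , T⊆block , unique
    where
    open Placement (placement T T-dim)
    T⊆block : T ⊆ block-at (k , F.fromℕ< i<n , F.fromℕ< t<N)
    T⊆block = subst₂ (λ i t → T ⊆ S k i t) (sym (toℕ-fromℕ< i<n)) (sym (toℕ-fromℕ< t<N)) T⊆S
    unique : ∀ y → T ⊆ block-at y → y ≡ (k , F.fromℕ< i<n , F.fromℕ< t<N)
    unique (k' , i' , t') T⊆S' =
      let k'≡k , i'≡i , t'≡t = placement-unique (plane T T-dim) (toℕ<n i') i<n (toℕ<n t') t<N T⊆S' T⊆S
      in  cong₂ _,_ k'≡k (cong₂ _,_ (toℕ-injective (trans i'≡i (sym (toℕ-fromℕ< i<n))))
                                    (toℕ-injective (trans t'≡t (sym (toℕ-fromℕ< t<N)))))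

  steiner : SteinerStructure2 2 3 n
  steiner = steiner-reindex {2} {3} Fin↔Index block-at (λ { (k , i , t) → S-dim k (F.toℕ i) (F.toℕ t) }) unique-block
    where
    Fin↔Index : Fin (M * (n * N)) ↔ Index
    Fin↔Index = (↔-id (Fin M) ×-↔ *↔×) ↔-∘ *↔×

open QuotientRing using (primitive≢0)
open NumberTheory using (prime⇒1<n; mersenne≡suc)
open import Data.Nat.Properties using (<⇒≤)
open import Data.Product using (_,_)

-- The main theorem: the blocks of Construction form a Steiner structure S₂[2,3,n].
mainTheorem7 : (n : ℕ) → Prime n → n % 6 ≡ 1 →
    (f α : V n) → IsFieldMod f → IsPrimitive f α →
    (Σ ℕ λ M → (M * (42 * n) ≡ 2 ^ n ∸ 2) ×
    Σ (Fin M → Fin 7 → ℕ) λ E →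
    (∀ k → IsCCSubspace f α (E k)) ×
    (∀ k l → ¬ (k ≡ l) → DisjointCΔ n (E k) (E l))) →
    SteinerStructure2 2 3 n
mainTheorem7 n n-prime _ f α field-f α-primitive (M , M≡ , E , subspaces , disjoint) =
  Construction.steiner n n-prime f α field-f α-primitive
    (2 ^ n ∸ 2) (mersenne≡suc n (<⇒≤ 1<n)) (primitive≢0 f α 1<n α-primitive)
    M M≡ E subspaces disjoint
  where
  1<n : 1 < n
  1<n = prime⇒1<n n-prime
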